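{- Let $\Phi_f=(G,F^\times,\varphi,f)$ be a skew gain graph whose underlying graph $G=(V,\overrightarrow{E})$ has order $n$. Then its Laplacian characteristic polynomial satisfies \[ \chi(\Phi_f,x)=\det(xI-L(\Phi_f))=\prod_{v\in V(G)}(x-d(v))+\sum_{L\in\mathfrak{L}(G)}(-1)^{K_e(L)}\prod_{K_2\in L}g(\varphi(\overrightarrow{e}))\prod_{C\in L}\big(\varphi(C)+f(\varphi(C))\big)\prod_{v\notin V(L)}(x-d(v)), \] where the first inner product runs over the $K_2$-components of $L$ (with $\overrightarrow{e}$ the edge of that component) and the second over the cycle components $C$ of $L$.
   Context: $F$ is a field of characteristic zero and $F^\times$ its multiplicative group; $f:F^\times\to F^\times$ is an involutive automorphism ($f(f(x))=x$, $f(xy)=f(x)f(y)$), and $g(x)=xf(x)$. $G$ is a finite simple connected graph on vertices $v_1,\dots,v_n$ with a fixed orientation of each edge. A skew gain graph $\Phi_f=(G,F^\times,\varphi,f)$ is given by a map $\varphi$ from oriented edges to $F^\times$ with $\varphi(\overrightarrow{vu})=f(\varphi(\overrightarrow{uv}))$; note $g(\varphi(\overrightarrow{vu}))=g(\varphi(\overrightarrow{uv}))$. The adjacency matrix $A(\Phi_f)=(a_{ij})$ has $a_{ij}=\varphi(\overrightarrow{v_iv_j})$ if $v_i\sim v_j$ and $0$ otherwise. The degree $d(v)\in F$ of a vertex is the sum of $d_v$ copies of $1\in F$, where $d_v$ is its degree in $G$; $D(\Phi_f)=\mathrm{diag}(d(v_1),\dots,d(v_n))$ and $L(\Phi_f)=D(\Phi_f)-A(\Phi_f)$.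 An elementary subgraph of $G$ is a subgraph each of whose components is either a $K_2$ (a single edge) or a cycle; $\mathfrak{L}(G)$ is the set of all nonempty elementary subgraphs of $G$, and $K_e(L)$ is the number of components of $L$ of even order. For a cycle $C=u_1u_2\cdots u_ku_1$, $\varphi(C)=\varphi(\overrightarrow{u_1u_2})\varphi(\overrightarrow{u_2u_3})\cdots\varphi(\overrightarrow{u_ku_1})$ (the gain along one traversal direction; the expression $\varphi(C)+f(\varphi(C))$ does not depend on the direction). Empty products equal $1$. -}

module Defs where

open import Level using (Level; _⊔_)
open import Algebra.Bundles using (CommutativeRing)
open import Data.Bool using (Bool; true; false; _∧_; not; if_then_else_; T)
open import Data.Nat using (ℕ; zero; suc; _<ᵇ_; _≤ᵇ_)
open import Data.Nat as ℕ using ()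
open import Data.Fin using (Fin; zero; suc; toℕ; punchIn)
open import Data.Fin.Properties using () renaming (_≟_ to _≟ᶠ_)
open import Data.List using (List; []; _∷_; _++_; [_]; map; concatMap; allFin;
  filterᵇ; foldr; length; upTo)
open import Data.Bool.ListAction using (all; any)
open import Data.Product using (Σ; _×_; _,_)
open import Relation.Nullary using (¬_; does)
open import Relation.Binary.PropositionalEquality using (_≡_)

sublists : ∀ {a} {A : Set a} → List A → List (List A)
sublists []       = [] ∷ []
sublists (x ∷ xs) = sublists xs ++ map (x ∷_) (sublists xs)

listsOfLength : (n k : ℕ) → List (List (Fin n))
listsOfLength n zero    = [] ∷ []
listsOfLength n (suc k) = concatMap (λ v → map (v ∷_) (listsOfLength n k)) (allFin n)

_==_ : ∀ {n} → Fin n → Fin n → Bool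
i == j = does (i ≟ᶠ j)

elemᵇ : ∀ {n} → Fin n → List (Fin n) → Bool
elemᵇ v = any (λ u → u == v)

distinctᵇ : ∀ {n} → List (Fin n) → Bool
distinctᵇ []       = true
distinctᵇ (x ∷ xs) = not (elemᵇ x xs) ∧ distinctᵇ xs

isEven : ℕ → Bool
isEven zero          = true
isEven (suc zero)    = false
isEven (suc (suc k)) = isEven k

record SimpleGraph (n : ℕ) : Set where
  field
    adj     : Fin n → Fin n → Bool
    symm    : ∀ i j → adj i j ≡ adj j i
    irrefl  : ∀ i → adj i i ≡ false

data Reachable {n : ℕ} (G : SimpleGraph n) : Fin n → Fin n → Set where
  here : ∀ {i} → Reachable G i i
  step : ∀ {i j k} → T (SimpleGraph.adj G i j) → Reachable G j k → Reachable G i k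

Connected : ∀ {n} → SimpleGraph n → Set
Connected {n} G = ∀ (i j : Fin n) → Reachable G i j

module _ {n : ℕ} (G : SimpleGraph n) where
  open SimpleGraph G

  degreeℕ : Fin n → ℕ
  degreeℕ v = length (filterᵇ (adj v) (allFin n))

  pathᵇ : List (Fin n) → Bool
  pathᵇ (u ∷ v ∷ rest) = adj u v ∧ pathᵇ (v ∷ rest)
  pathᵇ _              = true

  lastOr : Fin n → List (Fin n) → Fin n
  lastOr d []       = d
  lastOr d (x ∷ xs) = lastOr x xs

  -- A cycle C of G, written as its canonical cyclic vertex sequence u1 u2 ... uk:
  -- k ≥ 3 distinct vertices, u_i ~ u_{i+1}, u_k ~ u_1, u1 is the least vertex of C
  -- and u2 < uk (this picks exactly one of the 2k sequences describing C).
  canonicalCycleᵇ : List (Fin n) → Bool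
  canonicalCycleᵇ (u₁ ∷ u₂ ∷ u₃ ∷ rest) =
    distinctᵇ (u₁ ∷ u₂ ∷ u₃ ∷ rest)
    ∧ pathᵇ (u₁ ∷ u₂ ∷ u₃ ∷ rest)
    ∧ adj (lastOr u₃ rest) u₁
    ∧ all (λ v → toℕ u₁ ≤ᵇ toℕ v) (u₂ ∷ u₃ ∷ rest)
    ∧ (toℕ u₂ <ᵇ toℕ (lastOr u₃ rest))
  canonicalCycleᵇ _ = false

  data Comp : Set where
    k2  : Fin n → Fin n → Comp          -- the edge {i , j}, stored with i < j
    cyc : List (Fin n) → Comp           -- a cycle, canonical vertex sequence

  compVerts : Comp → List (Fin n)
  compVerts (k2 i j) = i ∷ j ∷ []
  compVerts (cyc us) = us

  allK2 : List Comp
  allK2 = concatMap (λ i → concatMap (λ j → if (toℕ i <ᵇ toℕ j) ∧ adj i j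
                                             then k2 i j ∷ [] else [])
                                     (allFin n))
                    (allFin n)

  allCycles : List Comp
  allCycles = map cyc (filterᵇ canonicalCycleᵇ
                        (concatMap (listsOfLength n) (upTo (suc n))))

  allComps : List Comp
  allComps = allK2 ++ allCycles

  vertsOf : List Comp → List (Fin n)
  vertsOf = concatMap compVerts

  -- L is a nonempty family of pairwise vertex-disjoint K2's and cycles of G,
  -- i.e. (the edge/vertex union of L is) a nonempty elementary subgraph of G
  isElementaryᵇ : List Comp → Bool
  isElementaryᵇ []      = false
  isElementaryᵇ (c ∷ L) = distinctᵇ (vertsOf (c ∷ L))

  elementarySubgraphs : List (List Comp)
  elementarySubgraphs = filterᵇ isElementaryᵇ (sublists allComps)

  Ke : List Comp → ℕ
  Ke L = length (filterᵇ (λ c → isEven (length (compVerts c))) L)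

module _ {c ℓ} (F : CommutativeRing c ℓ) where
  open CommutativeRing F using (Carrier; _≈_; _+_; _*_; -_; _-_; 0#; 1#)

  ofℕ : ℕ → Carrier
  ofℕ zero    = 0#
  ofℕ (suc m) = 1# + ofℕ m

  record IsFieldCharZero : Set (c ⊔ ℓ) where
    field
      1≉0      : ¬ (1# ≈ 0#)
      inverse  : ∀ x → ¬ (x ≈ 0#) → Σ Carrier (λ y → x * y ≈ 1#)
      charZero : ∀ m → ¬ (ofℕ (suc m) ≈ 0#)

  -- f : F^× → F^× an involutive automorphism (given as a function on F whose
  -- behaviour is only constrained on F^× = nonzero elements)
  record IsInvolutiveAutUnits (f : Carrier → Carrier) : Set (c ⊔ ℓ) where
    field
      cong     : ∀ x y → ¬ (x ≈ 0#) → x ≈ y → f x ≈ f y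
      unit     : ∀ x → ¬ (x ≈ 0#) → ¬ (f x ≈ 0#)
      involut  : ∀ x → ¬ (x ≈ 0#) → f (f x) ≈ x
      hom      : ∀ x y → ¬ (x ≈ 0#) → ¬ (y ≈ 0#) → f (x * y) ≈ f x * f y

  sumL : List Carrier → Carrier
  sumL = foldr _+_ 0#

  prodL : List Carrier → Carrier
  prodL = foldr _*_ 1#

  negOnePow : ℕ → Carrier
  negOnePow zero    = 1#
  negOnePow (suc m) = - negOnePow m

  Σ[_]_ : ∀ {n} → (Fin n → Carrier) → Carrier
  Σ[_]_ {n} h = sumL (map h (allFin n))

  det : ∀ n → (Fin n → Fin n → Carrier) → Carrier
  det zero    M = 1#
  det (suc n) M = sumL (map (λ j → negOnePow (toℕ j) * M zero j
                                   * det n (λ i k → M (suc i) (punchIn j k)))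
                            (allFin (suc n)))

  δ : ∀ {n} → Fin n → Fin n → Carrier
  δ i j = if i == j then 1# else 0#

  record IsSkewGain {n} (G : SimpleGraph n) (f : Carrier → Carrier)
                    (φ : Fin n → Fin n → Carrier) : Set (c ⊔ ℓ) where
    field
      nonzero : ∀ i j → T (SimpleGraph.adj G i j) → ¬ (φ i j ≈ 0#)
      skew    : ∀ i j → T (SimpleGraph.adj G i j) → φ j i ≈ f (φ i j)

  module _ {n} (G : SimpleGraph n) (f : Carrier → Carrier)
           (φ : Fin n → Fin n → Carrier) where
    open SimpleGraph G

    g : Carrier → Carrier
    g x = x * f x

    d : Fin n → Carrier
    d v = ofℕ (degreeℕ G v)

    adjMat : Fin n → Fin n → Carrier
    adjMat i j = if adj i j then φ i j else 0#

    degMat : Fin n → Fin n → Carrier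
    degMat i j = δ i j * d i

    laplacian : Fin n → Fin n → Carrier
    laplacian i j = degMat i j - adjMat i j

    -- χ(Φ_f, x) = det(xI − L(Φ_f)), evaluated at x ∈ F
    charPoly : Carrier → Carrier
    charPoly x = det n (λ i j → δ i j * x - laplacian i j)

    pathGain : List (Fin n) → Carrier
    pathGain (u ∷ v ∷ rest) = φ u v * pathGain (v ∷ rest)
    pathGain _              = 1#

    cycleGain : List (Fin n) → Carrier
    cycleGain []       = 1#
    cycleGain (u ∷ us) = pathGain ((u ∷ us) ++ [ u ])

    compWeight : Comp G → Carrier
    compWeight (k2 i j) = g (φ i j)
    compWeight (cyc us) = cycleGain us + f (cycleGain us)

    outside : Carrier → List (Comp G) → Carrier
    outside x L = prodL (map (λ v → x - d v)
                             (filterᵇ (λ v → not (elemᵇ v (vertsOf G L))) (allFin n)))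

    term : Carrier → List (Comp G) → Carrier
    term x L = negOnePow (Ke G L) * prodL (map compWeight L) * outside x L

    rhs : Carrier → Carrier
    rhs x = prodL (map (λ v → x - d v) (allFin n))
            + sumL (map (term x) (elementarySubgraphs G))

-- Write det(xI − L) as the principal minor Q(V) of M = xI − L and expand a principal minor
-- Q(S) at the least vertex v of S: developing along the row and the column of v, and then
-- recursively along the rows that appear, gives a sum over simple walks v t₁ … t_k v inside S of
-- (−1)^k M(v,t₁)⋯M(t_k,v) Q(S ∖ {v,t₁,…,t_k}). The empty walk contributes (x − d(v)) Q(S ∖ v);
-- a walk of length 1 is an edge vt and contributes −φ(vt) f(φ(vt)) = −g(φ(vt)); for k ≥ 2 a
-- walk and its reverse run around the same cycle C, with gains φ(C) and f(φ(C)). So Q(S) obeys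
-- the recursion "v is left out, or v lies on exactly one K₂ or cycle component", which also
-- characterises the signed sum over families of vertex-disjoint components inside S. By strong
-- induction on |S| the two agree, and for S = V that sum is the right-hand side.

module Submission where

open import Defs
open import Algebra.Bundles using (CommutativeRing)
open import Data.Bool using (true)
open import Data.Nat using (ℕ; suc; s≤s)
open import Data.Fin using (Fin)
open import Data.List using (allFin)
open import Relation.Binary.PropositionalEquality as ≡ using (_≡_)

-- The ring solver of the standard library needs a coefficient ring mapped into F; we use ℤ.
module IntegerCoefficientSolver {c ℓ} (F : CommutativeRing c ℓ) where

  open import Data.Nat as ℕ using (zero; suc)
  open import Data.Integer as ℤ using (ℤ; +_; -[1+_]; _⊖_)
  import Data.Integer.Properties as ℤP
  open import Data.Sign as Sign using (Sign)
  open import Data.Maybe using (Maybe; just; nothing)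
  open import Relation.Nullary using (yes; no)
  open import Relation.Binary.PropositionalEquality as ≡ using (_≡_)
  import Algebra.Solver.Ring.AlmostCommutativeRing as ACR
  open CommutativeRing F
  open import Algebra.Properties.Ring ring using (-‿distribˡ-*; -‿distribʳ-*; -‿involutive; -0#≈0#; -‿+-comm)
  open import Algebra.Properties.Semiring.Mult semiring using (_×_; ×-homo-+; ×1-homo-*)
  open import Relation.Binary.Reasoning.Setoid setoid

  signed : Sign → Carrier → Carrier
  signed Sign.+ x = x
  signed Sign.- x = - x

  ⟦_⟧ : ℤ → Carrier
  ⟦ i ⟧ = signed (ℤ.sign i) (ℤ.∣ i ∣ × 1#)

  ⟦◃⟧ : ∀ s n → ⟦ s ℤ.◃ n ⟧ ≈ signed s (n × 1#)
  ⟦◃⟧ Sign.+ zero    = refl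
  ⟦◃⟧ Sign.- zero    = sym -0#≈0#
  ⟦◃⟧ Sign.+ (suc n) = refl
  ⟦◃⟧ Sign.- (suc n) = refl

  signed-* : ∀ s t x y → signed (s Sign.* t) (x * y) ≈ signed s x * signed t y
  signed-* Sign.+ Sign.+ x y = refl
  signed-* Sign.+ Sign.- x y = -‿distribʳ-* x y
  signed-* Sign.- Sign.+ x y = -‿distribˡ-* x y
  signed-* Sign.- Sign.- x y = sym (begin
    - x * - y   ≈⟨ -‿distribˡ-* x (- y) ⟨
    - (x * - y) ≈⟨ -‿cong (-‿distribʳ-* x y) ⟨
    - - (x * y) ≈⟨ -‿involutive _ ⟩
    x * y       ∎)

  signed-cong : ∀ s {x y} → x ≈ y → signed s x ≈ signed s y
  signed-cong Sign.+ e = e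
  signed-cong Sign.- e = -‿cong e

  *-homo : ∀ i j → ⟦ i ℤ.* j ⟧ ≈ ⟦ i ⟧ * ⟦ j ⟧
  *-homo i j = begin
    ⟦ i ℤ.* j ⟧                                    ≈⟨ ⟦◃⟧ (ℤ.sign i Sign.* ℤ.sign j) (ℤ.∣ i ∣ ℕ.* ℤ.∣ j ∣) ⟩
    signed (ℤ.sign i Sign.* ℤ.sign j) ((ℤ.∣ i ∣ ℕ.* ℤ.∣ j ∣) × 1#)
                                                   ≈⟨ signed-cong (ℤ.sign i Sign.* ℤ.sign j) (×1-homo-* ℤ.∣ i ∣ ℤ.∣ j ∣) ⟩
    signed (ℤ.sign i Sign.* ℤ.sign j) ((ℤ.∣ i ∣ × 1#) * (ℤ.∣ j ∣ × 1#))
                                                   ≈⟨ signed-* (ℤ.sign i) (ℤ.sign j) _ _ ⟩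
    ⟦ i ⟧ * ⟦ j ⟧                                  ∎

  ⊖-homo : ∀ m n → ⟦ m ⊖ n ⟧ ≈ m × 1# - n × 1#
  ⊖-homo zero    zero    = sym (trans (+-congˡ -0#≈0#) (+-identityʳ _))
  ⊖-homo (suc m) zero    = sym (trans (+-congˡ -0#≈0#) (+-identityʳ _))
  ⊖-homo zero    (suc n) = sym (+-identityˡ _)
  ⊖-homo (suc m) (suc n) = begin
    ⟦ suc m ⊖ suc n ⟧                         ≡⟨ ≡.cong ⟦_⟧ (ℤP.[1+m]⊖[1+n]≡m⊖n m n) ⟩
    ⟦ m ⊖ n ⟧                                 ≈⟨ ⊖-homo m n ⟩
    M - N                                     ≈⟨ +-identityˡ _ ⟨
    0# + (M - N)                              ≈⟨ +-congʳ (-‿inverseʳ 1#) ⟨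
    (1# - 1#) + (M - N)                       ≈⟨ +-assoc _ _ _ ⟩
    1# + (- 1# + (M - N))                     ≈⟨ +-congˡ (trans (sym (+-assoc _ _ _)) (trans (+-congʳ (+-comm _ _)) (+-assoc _ _ _))) ⟩
    1# + (M + (- 1# - N))                     ≈⟨ +-assoc _ _ _ ⟨
    (1# + M) + (- 1# - N)                     ≈⟨ +-congˡ (-‿+-comm 1# N) ⟩
    (1# + M) - (1# + N)                       ∎
    where M = m × 1#; N = n × 1#

  +-homo : ∀ i j → ⟦ i ℤ.+ j ⟧ ≈ ⟦ i ⟧ + ⟦ j ⟧
  +-homo (+ m)    (+ n)    = ×-homo-+ 1# m n
  +-homo (+ m)    -[1+ n ] = ⊖-homo m (suc n)
  +-homo -[1+ m ] (+ n)    = trans (⊖-homo n (suc m)) (+-comm _ _)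
  +-homo -[1+ m ] -[1+ n ] = begin
    - (1# + (suc m ℕ.+ n) × 1#)     ≈⟨ -‿cong (+-congˡ (×-homo-+ 1# (suc m) n)) ⟩
    - (1# + (suc m × 1# + n × 1#))  ≈⟨ -‿cong (trans (sym (+-assoc _ _ _)) (trans (+-congʳ (+-comm _ _)) (+-assoc _ _ _))) ⟩
    - (suc m × 1# + (1# + n × 1#))  ≈⟨ -‿+-comm _ _ ⟨
    - (suc m × 1#) - suc n × 1#     ∎

  -‿homo : ∀ i → ⟦ ℤ.- i ⟧ ≈ - ⟦ i ⟧
  -‿homo -[1+ n ]    = sym (-‿involutive _)
  -‿homo (+ zero)    = sym -0#≈0#
  -‿homo (+ suc n)   = refl

  almostCommutativeRing : ACR.AlmostCommutativeRing c ℓ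
  almostCommutativeRing = ACR.fromCommutativeRing F

  ℤ⟶F : ℤ.+-*-rawRing ACR.-Raw-AlmostCommutative⟶ almostCommutativeRing
  ℤ⟶F = record
    { ⟦_⟧ = ⟦_⟧ ; +-homo = +-homo ; *-homo = *-homo ; -‿homo = -‿homo
    ; 0-homo = refl ; 1-homo = +-identityʳ 1# }

  ⟦⟧-≟ : ∀ i j → Maybe (⟦ i ⟧ ≈ ⟦ j ⟧)
  ⟦⟧-≟ i j with i ℤ.≟ j
  ... | yes ≡.refl = just refl
  ... | no _       = nothing

  open import Algebra.Solver.Ring ℤ.+-*-rawRing almostCommutativeRing ℤ⟶F ⟦⟧-≟ public
    using (solve; _:=_; _:+_; _:*_; :-_; _:-_; con)
module FinBool where

  open import Data.Bool using (Bool; true; false; if_then_else_; not; _∧_; _∨_; T)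
  open import Data.Nat using (ℕ; zero; suc; _<_; _≤_; s≤s; z≤n; _<ᵇ_)
  open import Data.Unit using (tt)
  open import Relation.Binary using (tri<; tri≈; tri>)
  import Data.Nat.Properties as NP
  open import Data.Fin using (Fin; zero; suc)
  open import Data.Fin.Properties using () renaming (_≟_ to _≟ᶠ_)
  open import Data.List using (List; []; _∷_; filterᵇ; length)
  open import Data.Bool.ListAction using (all)
  open import Data.List.Membership.Propositional using (_∈_)
  open import Data.List.Relation.Unary.Any using (here; there)
  open import Data.List.Relation.Unary.All using ([]; _∷_)
  open import Data.List.Relation.Unary.AllPairs using ([]; _∷_)
  open import Relation.Nullary using (yes; no; ¬_)
  open import Relation.Binary.PropositionalEquality as ≡ using (_≡_; _≢_)
  open import Data.Empty using (⊥-elim)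
  open import Data.Product using (Σ; _×_; _,_)
  open import Defs

  filterᵇ-cons : ∀ {a} {A : Set a} (p : A → Bool) x xs →
    filterᵇ p (x ∷ xs) ≡ (if p x then x ∷ filterᵇ p xs else filterᵇ p xs)
  filterᵇ-cons p x xs with p x
  ... | true = ≡.refl
  ... | false = ≡.refl

  module _ {n : ℕ} where
    ==-refl : ∀ (a : Fin n) → (a == a) ≡ true
    ==-refl a with a ≟ᶠ a
    ... | yes _ = ≡.refl
    ... | no a≢a = ⊥-elim (a≢a ≡.refl)

    ==-true : ∀ (a b : Fin n) → (a == b) ≡ true → a ≡ b
    ==-true a b e with a ≟ᶠ b
    ... | yes eq = eq
    ==-true a b () | no _

    ==-false : ∀ (a b : Fin n) → a ≢ b → (a == b) ≡ false
    ==-false a b a≢b with a ≟ᶠ b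
    ... | yes eq = ⊥-elim (a≢b eq)
    ... | no _ = ≡.refl

    ==-false⇒≢ : ∀ (a b : Fin n) → (a == b) ≡ false → a ≢ b
    ==-false⇒≢ a b e eq rewrite eq | ==-refl b = case e
      where case : true ≡ false → _
            case ()

    ==-sym : ∀ (a b : Fin n) → (a == b) ≡ (b == a)
    ==-sym a b with a ≟ᶠ b | b ≟ᶠ a
    ... | yes _ | yes _ = ≡.refl
    ... | no _ | no _ = ≡.refl
    ... | yes e | no b≢a = ⊥-elim (b≢a (≡.sym e))
    ... | no a≢b | yes e = ⊥-elim (a≢b (≡.sym e))

  filter-all-true : ∀ {a} {A : Set a} (xs : List A) → filterᵇ (λ _ → true) xs ≡ xs
  filter-all-true [] = ≡.refl
  filter-all-true (x ∷ xs) = ≡.cong (x ∷_) (filter-all-true xs)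

  filter-cong : ∀ {a} {A : Set a} {p q : A → Bool} (xs : List A) → (∀ x → p x ≡ q x) → filterᵇ p xs ≡ filterᵇ q xs
  filter-cong [] e = ≡.refl
  filter-cong {p = p} {q} (x ∷ xs) e = ≡.trans (filterᵇ-cons p x xs) (≡.trans (≡.cong (λ b → if b then x ∷ filterᵇ p xs else filterᵇ p xs) (e x))
    (≡.trans (≡.cong (λ z → if q x then x ∷ z else z) (filter-cong xs e)) (≡.sym (filterᵇ-cons q x xs))))

  filter-true : ∀ {a} {A : Set a} (p : A → Bool) x xs → p x ≡ true → filterᵇ p (x ∷ xs) ≡ x ∷ filterᵇ p xs
  filter-true p x xs e = ≡.trans (filterᵇ-cons p x xs) (≡.cong (λ b → if b then x ∷ filterᵇ p xs else filterᵇ p xs) e)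

  filter-false : ∀ {a} {A : Set a} (p : A → Bool) x xs → p x ≡ false → filterᵇ p (x ∷ xs) ≡ filterᵇ p xs
  filter-false p x xs e = ≡.trans (filterᵇ-cons p x xs) (≡.cong (λ b → if b then x ∷ filterᵇ p xs else filterᵇ p xs) e)

  ∧-true : ∀ {a b} → (a ∧ b) ≡ true → (a ≡ true) × (b ≡ true)
  ∧-true {true} {true} _ = ≡.refl , ≡.refl

  not-true : ∀ {a} → not a ≡ true → a ≡ false
  not-true {false} _ = ≡.refl

  not-false : ∀ {a} → not a ≡ false → a ≡ true
  not-false {true} _ = ≡.refl

  T⇒≡true : ∀ {b} → T b → b ≡ true
  T⇒≡true {true} _ = ≡.refl

  ¬T⇒≡false : ∀ {b} → ¬ T b → b ≡ false
  ¬T⇒≡false {true} n = ⊥-elim (n tt)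
  ¬T⇒≡false {false} _ = ≡.refl

  not-<ᵇ-flip : ∀ m n → m ≢ n → not (n <ᵇ m) ≡ (m <ᵇ n)
  not-<ᵇ-flip m n m≢n with NP.<-cmp m n
  ... | tri< a _ _ = ≡.trans (≡.cong not (¬T⇒≡false (λ t → NP.<-asym a (NP.<ᵇ⇒< n m t)))) (≡.sym (T⇒≡true (NP.<⇒<ᵇ a)))
  ... | tri≈ _ e _ = ⊥-elim (m≢n e)
  ... | tri> _ _ c = ≡.trans (≡.cong not (T⇒≡true (NP.<⇒<ᵇ c))) (≡.sym (¬T⇒≡false (λ t → NP.<-asym c (NP.<ᵇ⇒< m n t))))

  ∨-false : ∀ {a b} → (a ∨ b) ≡ false → (a ≡ false) × (b ≡ false)
  ∨-false {false} {false} _ = ≡.refl , ≡.refl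

  Fin⇒suc : ∀ {m} → Fin m → Σ ℕ (λ m' → m ≡ suc m')
  Fin⇒suc {suc m} _ = m , ≡.refl

  <ᵇ-irrefl : ∀ m → (m <ᵇ m) ≡ false
  <ᵇ-irrefl m = ¬T⇒≡false (λ t → NP.<-irrefl ≡.refl (NP.<ᵇ⇒< m m t))

  module _ {a} {A : Set a} (p q : A → Bool) (imp : ∀ x → q x ≡ true → p x ≡ true) where
    length-filter-mono : ∀ xs → length (filterᵇ q xs) ≤ length (filterᵇ p xs)
    length-filter-mono [] = z≤n
    length-filter-mono (x ∷ xs) with p x in ep | q x in eq
    ... | true | true = s≤s (length-filter-mono xs)
    ... | true | false = NP.m≤n⇒m≤1+n (length-filter-mono xs)
    ... | false | false = length-filter-mono xs
    ... | false | true with () ← ≡.trans (≡.sym ep) (imp x eq)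

    length-filter-mono-< : ∀ xs y → y ∈ xs → p y ≡ true → q y ≡ false → length (filterᵇ q xs) < length (filterᵇ p xs)
    length-filter-mono-< (x ∷ xs) y (here ≡.refl) py qy rewrite filter-true p x xs py | filter-false q x xs qy = s≤s (length-filter-mono xs)
    length-filter-mono-< (x ∷ xs) y (there m) py qy with p x in ep | q x in eq
    ... | true | true = s≤s (length-filter-mono-< xs y m py qy)
    ... | true | false = NP.m≤n⇒m≤1+n (length-filter-mono-< xs y m py qy)
    ... | false | false = length-filter-mono-< xs y m py qy
    ... | false | true with () ← ≡.trans (≡.sym ep) (imp x eq)

  filter-cong∈ : ∀ {a} {A : Set a} {p q : A → Bool} (xs : List A) → (∀ x → x ∈ xs → p x ≡ q x) → filterᵇ p xs ≡ filterᵇ q xs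
  filter-cong∈ [] e = ≡.refl
  filter-cong∈ {p = p} {q} (x ∷ xs) e = ≡.trans (filterᵇ-cons p x xs) (≡.trans (≡.cong (λ b → if b then x ∷ filterᵇ p xs else filterᵇ p xs) (e x (here ≡.refl)))
    (≡.trans (≡.cong (λ z → if q x then x ∷ z else z) (filter-cong∈ xs (λ y m → e y (there m)))) (≡.sym (filterᵇ-cons q x xs))))

  all-∧-not : ∀ {n} (p : Fin n → Bool) (t : Fin n) s →
    all (λ w → p w ∧ not (w == t)) s ≡ (all p s ∧ not (elemᵇ t s))
  all-∧-not p t [] = ≡.refl
  all-∧-not p t (x ∷ s) rewrite all-∧-not p t s with p x | x == t | all p s | elemᵇ t s
  ... | a | b | c | d = lem a b c d
    where
    lem : ∀ a b c d → (a ∧ not b) ∧ (c ∧ not d) ≡ ((a ∧ c) ∧ not (b ∨ d))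
    lem true true true d = ≡.refl
    lem true true false d = ≡.refl
    lem true false true d = ≡.refl
    lem true false false d = ≡.refl
    lem false b c d = ≡.refl


module ListBool where

  open import Data.Bool using (Bool; true; false; not; _∧_; _∨_)
  open import Data.Bool.Solver
  open import Data.Nat using (ℕ)
  open import Data.Fin using (Fin)
  open import Data.List using (List; []; _∷_; _++_)
  open import Data.Bool.ListAction using (any)
  open import Relation.Binary.PropositionalEquality as ≡ using (_≡_)
  open import Defs
  open FinBool

  module BS = ∨-∧-Solver
  open import Data.Bool.Properties public using (∧-identityʳ; ∨-identityʳ; ∧-zeroʳ; ∨-zeroʳ; ∧-comm; ∧-assoc)

  not-∨ : ∀ a b → not (a ∨ b) ≡ (not a ∧ not b)
  not-∨ true b = ≡.refl
  not-∨ false b = ≡.refl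

  module _ {a} {A : Set a} where
    any-cong : ∀ {p q : A → Bool} X → (∀ w → p w ≡ q w) → any p X ≡ any q X
    any-cong [] e = ≡.refl
    any-cong (x ∷ X) e = ≡.cong₂ _∨_ (e x) (any-cong X e)

    any-∨ : ∀ (p q : A → Bool) X → any (λ w → p w ∨ q w) X ≡ (any p X ∨ any q X)
    any-∨ p q [] = ≡.refl
    any-∨ p q (x ∷ X) rewrite any-∨ p q X = BS.solve 4 (λ a b c d → (a BS.:+ b) BS.:+ (c BS.:+ d) BS.:= (a BS.:+ c) BS.:+ (b BS.:+ d)) ≡.refl (p x) (q x) (any p X) (any q X)

    any-++ : ∀ (p : A → Bool) X Y → any p (X ++ Y) ≡ (any p X ∨ any p Y)
    any-++ p [] Y = ≡.refl
    any-++ p (x ∷ X) Y rewrite any-++ p X Y = BS.solve 3 (λ a b c → a BS.:+ (b BS.:+ c) BS.:= (a BS.:+ b) BS.:+ c) ≡.refl (p x) (any p X) (any p Y)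

    any-false : ∀ X → any (λ (_ : A) → false) X ≡ false
    any-false [] = ≡.refl
    any-false (x ∷ X) = any-false X

  module _ {n : ℕ} where
    elem-++ : ∀ (w : Fin n) X Y → elemᵇ w (X ++ Y) ≡ (elemᵇ w X ∨ elemᵇ w Y)
    elem-++ w X Y = any-++ (λ u → u == w) X Y

    elem-sym : ∀ (v : Fin n) X → any (λ w → v == w) X ≡ elemᵇ v X
    elem-sym v X = any-cong X (λ w → ==-sym v w)

    any-elem : ∀ (p : Fin n → Bool) (v : Fin n) X → elemᵇ v X ≡ true → p v ≡ true → any p X ≡ true
    any-elem p v (x ∷ X) e pv with x == v in xv
    ... | true rewrite ==-true x v xv | pv = ≡.refl
    ... | false with p x
    ...   | true = ≡.refl
    ...   | false = any-elem p v X e pv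

    disjoint-sym : ∀ (A B : List (Fin n)) → any (λ w → elemᵇ w A) B ≡ any (λ w → elemᵇ w B) A
    disjoint-sym A [] = ≡.sym (any-false A)
    disjoint-sym A (b ∷ B) = ≡.sym (≡.trans (any-∨ (λ w → b == w) (λ w → elemᵇ w B) A)
                                    (≡.cong₂ _∨_ (elem-sym b A) (≡.sym (disjoint-sym A B))))

    distinct-++ : ∀ (A B : List (Fin n)) → distinctᵇ (A ++ B) ≡ (distinctᵇ A ∧ (distinctᵇ B ∧ not (any (λ w → elemᵇ w A) B)))
    distinct-++ [] B = ≡.sym (≡.trans (≡.cong (λ z → distinctᵇ B ∧ not z) (any-false B)) (∧-identityʳ _))
    distinct-++ (a ∷ A) B =
      ≡.trans (≡.cong₂ (λ u z → not u ∧ z) (elem-++ a A B) (distinct-++ A B))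
      (≡.trans (lem (elemᵇ a A) (elemᵇ a B) (distinctᵇ A) (distinctᵇ B) (any (λ w → elemᵇ w A) B))
        (≡.cong (λ z → (not (elemᵇ a A) ∧ distinctᵇ A) ∧ (distinctᵇ B ∧ not z))
          (≡.trans (≡.cong₂ _∨_ (≡.sym (elem-sym a B)) ≡.refl) (≡.sym (any-∨ (λ w → a == w) (λ w → elemᵇ w A) B)))))
      where
      lem : ∀ p q r s t → (not (p ∨ q) ∧ (r ∧ (s ∧ not t))) ≡ ((not p ∧ r) ∧ (s ∧ not (q ∨ t)))
      lem p q r s t rewrite not-∨ p q | not-∨ q t =
        BS.solve 5 (λ a b c d e → (a BS.:* b) BS.:* (c BS.:* (d BS.:* e)) BS.:= (a BS.:* c) BS.:* (d BS.:* (b BS.:* e))) ≡.refl (not p) (not q) r s (not t)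


module Summation where

  open import Algebra.Bundles using (CommutativeRing)
  open import Data.Bool using (Bool; true; false; if_then_else_; not; _∧_)
  open import Data.Nat using (zero; suc)
  open import Data.Nat using () renaming (suc to ℕs)
  open import Data.Fin using (Fin; zero; suc)
  open import Data.List using (List; []; _∷_; _++_; map; concatMap; filterᵇ; upTo)
  import Data.List.Properties as LP
  open import Data.List.Membership.Propositional using (_∈_)
  open import Data.List.Relation.Unary.Any using (here; there)
  open import Relation.Binary.PropositionalEquality as ≡ using (_≡_)
  import Data.List.Relation.Unary.All as All
  open import Data.List.Relation.Unary.AllPairs using (_∷_)
  open import Data.List.Relation.Unary.Unique.Propositional using (Unique)
  open import Defs
  open FinBool using (==-sym; ==-false)

  module Sums {c ℓ} (F : CommutativeRing c ℓ) where
    open CommutativeRing F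
    open import Relation.Binary.Reasoning.Setoid setoid
    open IntegerCoefficientSolver F public using (solve; _:=_; _:+_; _:*_; :-_; _:-_; con)
    open import Algebra.Properties.Ring ring public using (-0#≈0#; -‿distribˡ-*; -‿distribʳ-*; -‿involutive)

    ∑ : List Carrier → Carrier
    ∑ = sumL F

    altSum : List Carrier → Carrier
    altSum [] = 0#
    altSum (x ∷ xs) = x - altSum xs

    sum-++ : ∀ (xs ys : List Carrier) → ∑ (xs ++ ys) ≈ ∑ xs + ∑ ys
    sum-++ [] ys = sym (+-identityˡ _)
    sum-++ (x ∷ xs) ys = trans (+-congˡ (sum-++ xs ys)) (sym (+-assoc _ _ _))

    module _ {a} {A : Set a} where
      sum-cong-∈ : ∀ {f g : A → Carrier} (xs : List A) → (∀ x → x ∈ xs → f x ≈ g x) →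
                 ∑ (map f xs) ≈ ∑ (map g xs)
      sum-cong-∈ [] h = refl
      sum-cong-∈ (x ∷ xs) h = +-cong (h x (here ≡.refl)) (sum-cong-∈ xs (λ y m → h y (there m)))

      sum-cong : ∀ {f g : A → Carrier} (xs : List A) → (∀ x → f x ≈ g x) →
                 ∑ (map f xs) ≈ ∑ (map g xs)
      sum-cong xs h = sum-cong-∈ xs (λ x _ → h x)

      sum-+ : ∀ (f g : A → Carrier) xs → ∑ (map (λ x → f x + g x) xs) ≈ ∑ (map f xs) + ∑ (map g xs)
      sum-+ f g [] = sym (+-identityˡ _)
      sum-+ f g (x ∷ xs) = trans (+-congˡ (sum-+ f g xs))
        (solve 4 (λ a b c d → (a :+ b) :+ (c :+ d) := (a :+ c) :+ (b :+ d)) refl _ _ _ _)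

      sum-neg : ∀ (f : A → Carrier) xs → ∑ (map (λ x → - f x) xs) ≈ - ∑ (map f xs)
      sum-neg f [] = sym (-0#≈0#)
      sum-neg f (x ∷ xs) = trans (+-congˡ (sum-neg f xs))
        (solve 2 (λ a b → :- a :+ :- b := :- (a :+ b)) refl _ _)

      sum-scale : ∀ (k : Carrier) (f : A → Carrier) xs → ∑ (map (λ x → k * f x) xs) ≈ k * ∑ (map f xs)
      sum-scale k f [] = sym (zeroʳ _)
      sum-scale k f (x ∷ xs) = trans (+-congˡ (sum-scale k f xs)) (sym (distribˡ _ _ _))

      sum-zero : ∀ (f : A → Carrier) xs → (∀ x → x ∈ xs → f x ≈ 0#) → ∑ (map f xs) ≈ 0#
      sum-zero f [] h = refl
      sum-zero f (x ∷ xs) h = trans (+-cong (h x (here ≡.refl)) (sum-zero f xs (λ y m → h y (there m)))) (+-identityˡ _)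

      sum-filter : ∀ (p : A → Bool) (f : A → Carrier) xs →
        ∑ (map f (filterᵇ p xs)) ≈ ∑ (map (λ x → if p x then f x else 0#) xs)
      sum-filter p f [] = refl
      sum-filter p f (x ∷ xs) with p x
      ... | true = +-congˡ (sum-filter p f xs)
      ... | false = trans (sum-filter p f xs) (sym (+-identityˡ _))

      alt-cong : ∀ {f g : A → Carrier} (xs : List A) → (∀ x → f x ≈ g x) →
                 altSum (map f xs) ≈ altSum (map g xs)
      alt-cong [] h = refl
      alt-cong (x ∷ xs) h = +-cong (h x) (-‿cong (alt-cong xs h))

      alt-sub : ∀ (f g : A → Carrier) xs → altSum (map (λ x → f x - g x) xs) ≈ altSum (map f xs) - altSum (map g xs)
      alt-sub f g [] = solve 0 (con (ℤ.+ 0) := con (ℤ.+ 0) :- con (ℤ.+ 0)) refl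
        where import Data.Integer as ℤ
      alt-sub f g (x ∷ xs) = trans (+-congˡ (-‿cong (alt-sub f g xs)))
        (solve 4 (λ a b c d → (a :- b) :- (c :- d) := (a :- c) :- (b :- d)) refl _ _ _ _)

      alt-neg : ∀ (f : A → Carrier) xs → altSum (map (λ x → - f x) xs) ≈ - altSum (map f xs)
      alt-neg f [] = sym (-0#≈0#)
      alt-neg f (x ∷ xs) = trans (+-congˡ (-‿cong (alt-neg f xs)))
        (solve 2 (λ a b → :- a :- :- b := :- (a :- b)) refl _ _)

      alt-scale : ∀ (k : Carrier) (f : A → Carrier) xs → altSum (map (λ x → k * f x) xs) ≈ k * altSum (map f xs)
      alt-scale k f [] = sym (zeroʳ _)
      alt-scale k f (x ∷ xs) = trans (+-congˡ (-‿cong (alt-scale k f xs)))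
        (solve 3 (λ k a b → k :* a :- k :* b := k :* (a :- b)) refl _ _ _)

      sum-concatMap : ∀ {b} {B : Set b} (f : B → Carrier) (g : A → List B) xs →
        ∑ (map f (concatMap g xs)) ≈ ∑ (map (λ x → ∑ (map f (g x))) xs)
      sum-concatMap f g [] = refl
      sum-concatMap f g (x ∷ xs) = trans (reflexive (≡.cong ∑ (LP.map-++ f (g x) (concatMap g xs))))
        (trans (sum-++ (map f (g x)) _) (+-congˡ (sum-concatMap f g xs)))

      sum-if : ∀ (b : Bool) (f : A → Carrier) xs → ∑ (map (λ x → if b then f x else 0#) xs) ≈ (if b then ∑ (map f xs) else 0#)
      sum-if true f xs = refl
      sum-if false f xs = sum-zero _ xs (λ _ _ → refl)

    if-cong : ∀ (b : Bool) {x y : Carrier} → (b ≡ true → x ≈ y) → (if b then x else 0#) ≈ (if b then y else 0#)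
    if-cong true e = e ≡.refl
    if-cong false e = refl

    if-neg : ∀ (b : Bool) (x : Carrier) → - (if b then x else 0#) ≈ (if b then - x else 0#)
    if-neg true x = refl
    if-neg false x = -0#≈0#

    if-scale : ∀ (b : Bool) (k x : Carrier) → k * (if b then x else 0#) ≈ (if b then k * x else 0#)
    if-scale true k x = refl
    if-scale false k x = zeroʳ k

    if-true : ∀ {b} (X : Carrier) → b ≡ true → (if b then X else 0#) ≡ X
    if-true X ≡.refl = ≡.refl

    if-false : ∀ {b} (X : Carrier) → b ≡ false → (if b then X else 0#) ≡ 0#
    if-false X ≡.refl = ≡.refl

    if-distrib : ∀ b s A k B → (if b then s * (A + k * B) else 0#) ≈ ((if b then s * A else 0#) + k * (if b then s * B else 0#))
    if-distrib true s A k B = solve 4 (λ s a k b → s :* (a :+ k :* b) := s :* a :+ k :* (s :* b)) refl s A k B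
    if-distrib false s A k B = sym (trans (+-congˡ (zeroʳ k)) (+-identityʳ 0#))

    if-flag : ∀ {b b'} (X Y : Carrier) → b ≡ b' → X ≈ Y → (if b then X else 0#) ≈ (if b' then Y else 0#)
    if-flag {true} X Y ≡.refl e = e
    if-flag {false} X Y ≡.refl e = refl

    if-mul : ∀ (a b : Bool) (X Y : Carrier) → (if a then X else 0#) * (if b then Y else 0#) ≈ (if a ∧ b then X * Y else 0#)
    if-mul true true X Y = refl
    if-mul true false X Y = zeroʳ _
    if-mul false b X Y = zeroˡ _

    if-zero : ∀ (b : Bool) {X : Carrier} → (b ≡ true → X ≈ 0#) → (if b then X else 0#) ≈ 0#
    if-zero true e = e ≡.refl
    if-zero false e = refl

    if-in : ∀ (b : Bool) a X c → a * (if b then X else 0#) * c ≈ (if b then a * X * c else 0#)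
    if-in true a X c = refl
    if-in false a X c = trans (*-congʳ (zeroʳ a)) (zeroˡ c)

    if-split : ∀ (b l : Bool) X → (if b then X else 0#) ≈ (if b ∧ l then X else 0#) + (if b ∧ not l then X else 0#)
    if-split true true X = sym (+-identityʳ _)
    if-split true false X = sym (+-identityˡ _)
    if-split false l X = sym (+-identityʳ _)

    if-nest : ∀ (a b : Bool) k X → (if a then k * (if b then X else 0#) else 0#) ≈ (if a ∧ b then k * X else 0#)
    if-nest true true k X = refl
    if-nest true false k X = zeroʳ k
    if-nest false b k X = refl

    sum-single : ∀ {n} (v : Fin n) (H : Fin n → Carrier) xs → Unique xs → v ∈ xs → (∀ i → (i == v) ≡ false → H i ≈ 0#) → ∑ (map H xs) ≈ H v
    sum-single v H (y ∷ ys) (y∉ ∷ u) (here ≡.refl) hz =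
      trans (+-congˡ (sum-zero H ys (λ i m → hz i (≡.trans (==-sym i y) (==-false y i (All.lookup y∉ m)))))) (+-identityʳ _)
    sum-single v H (y ∷ ys) (y∉ ∷ u) (there m) hz =
      trans (+-congʳ (hz y (==-false y v (All.lookup y∉ m)))) (trans (+-identityˡ _) (sum-single v H ys u m hz))

    sum-swap : ∀ {a b} {A : Set a} {B : Set b} (h : A → B → Carrier) xs ys →
      ∑ (map (λ x → ∑ (map (h x) ys)) xs) ≈ ∑ (map (λ y → ∑ (map (λ x → h x y) xs)) ys)
    sum-swap h [] ys = sym (sum-zero _ ys (λ _ _ → refl))
    sum-swap h (x ∷ xs) ys = trans (+-congˡ (sum-swap h xs ys)) (sym (sum-+ (h x) _ ys))

    upTo-suc : ∀ K → upTo (ℕs K) ≡ 0 ∷ map ℕs (upTo K)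
    upTo-suc K = ≡.cong (0 ∷_) (≡.sym (LP.map-upTo ℕs K))

    onlyAt0 : ℕ → Carrier → Carrier
    onlyAt0 zero X = X
    onlyAt0 (suc _) X = 0#

    onlyAt1 : ℕ → Carrier → Carrier
    onlyAt1 (suc zero) X = X
    onlyAt1 _ X = 0#

    sum-onlyAt0 : ∀ N′ X → ∑ (map (λ k → onlyAt0 k X) (upTo (suc N′))) ≈ X
    sum-onlyAt0 N′ X = trans (reflexive (≡.cong (λ z → ∑ (map (λ k → onlyAt0 k X) z)) (upTo-suc N′)))
      (trans (+-congˡ (trans (reflexive (≡.cong ∑ (≡.sym (LP.map-∘ (upTo N′))))) (sum-zero _ (upTo N′) (λ _ _ → refl)))) (+-identityʳ _))

    sum-onlyAt1 : ∀ N'' Y → ∑ (map (λ k → onlyAt1 k Y) (upTo (suc (suc N'')))) ≈ Y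
    sum-onlyAt1 N'' Y = trans (reflexive (≡.cong (λ z → ∑ (map (λ k → onlyAt1 k Y) z)) (≡.trans (upTo-suc (suc N'')) (≡.cong (λ z → 0 ∷ map suc z) (upTo-suc N'')))))
      (trans (+-identityˡ _) (trans (+-congˡ (trans (reflexive (≡.cong ∑ (≡.trans (≡.sym (LP.map-∘ (map suc (upTo N'')))) (≡.sym (LP.map-∘ (upTo N''))))))
                                                  (sum-zero _ (upTo N'') (λ _ _ → refl)))) (+-identityʳ _)))


module ListDeterminant where

  open import Algebra.Bundles using (CommutativeRing)
  open import Data.Nat using (zero; suc)
  open import Data.Fin using (Fin; zero; suc; toℕ; punchIn)
  open import Data.List using (List; []; _∷_; _++_; [_]; map; allFin)
  import Data.List.Properties as LP
  open import Data.Product using (_×_; _,_; proj₁; proj₂)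
  open import Relation.Binary.PropositionalEquality as ≡ using (_≡_)
  open import Defs
  open Summation

  selections : ∀ {a} {A : Set a} → List A → List (A × List A)
  selections [] = []
  selections (x ∷ xs) = (x , xs) ∷ map (λ p → proj₁ p , x ∷ proj₂ p) (selections xs)

  selections-map : ∀ {a b} {A : Set a} {B : Set b} (f : A → B) (xs : List A) →
    selections (map f xs) ≡ map (λ p → f (proj₁ p) , map f (proj₂ p)) (selections xs)
  selections-map f [] = ≡.refl
  selections-map f (x ∷ xs) = ≡.cong ((f x , map f xs) ∷_) (begin
      map (λ p → proj₁ p , f x ∷ proj₂ p) (selections (map f xs))
        ≡⟨ ≡.cong (map _) (selections-map f xs) ⟩
      map (λ p → proj₁ p , f x ∷ proj₂ p) (map (λ p → f (proj₁ p) , map f (proj₂ p)) (selections xs))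
        ≡⟨ ≡.sym (LP.map-∘ (selections xs)) ⟩
      map (λ p → f (proj₁ p) , f x ∷ map f (proj₂ p)) (selections xs)
        ≡⟨ LP.map-∘ (selections xs) ⟩
      map (λ p → f (proj₁ p) , map f (proj₂ p)) (map (λ p → proj₁ p , x ∷ proj₂ p) (selections xs)) ∎)
    where open ≡.≡-Reasoning

  allFin-suc : ∀ n → allFin (suc n) ≡ zero ∷ map suc (allFin n)
  allFin-suc n = ≡.cong (zero ∷_) (≡.sym (LP.map-tabulate (λ i → i) suc))

  selections-allFin : ∀ n → selections (allFin (suc n)) ≡ map (λ j → j , map (punchIn j) (allFin n)) (allFin (suc n))
  selections-allFin zero = ≡.refl
  selections-allFin (suc n) = begin
      selections (allFin (suc (suc n)))
        ≡⟨ ≡.cong selections (allFin-suc (suc n)) ⟩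
      (zero , map suc (allFin (suc n))) ∷ map (λ p → proj₁ p , zero ∷ proj₂ p) (selections (map suc (allFin (suc n))))
        ≡⟨ ≡.cong (λ z → (zero , map suc (allFin (suc n))) ∷ map (λ p → proj₁ p , zero ∷ proj₂ p) z) (selections-map suc (allFin (suc n))) ⟩
      (zero , map suc (allFin (suc n))) ∷ map (λ p → proj₁ p , zero ∷ proj₂ p) (map (λ p → suc (proj₁ p) , map suc (proj₂ p)) (selections (allFin (suc n))))
        ≡⟨ ≡.cong (λ z → (zero , map suc (allFin (suc n))) ∷ map (λ p → proj₁ p , zero ∷ proj₂ p) (map (λ p → suc (proj₁ p) , map suc (proj₂ p)) z)) (selections-allFin n) ⟩
      (zero , map suc (allFin (suc n))) ∷ map (λ p → proj₁ p , zero ∷ proj₂ p) (map (λ p → suc (proj₁ p) , map suc (proj₂ p)) (map (λ j → j , map (punchIn j) (allFin n)) (allFin (suc n))))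
        ≡⟨ ≡.cong ((zero , map suc (allFin (suc n))) ∷_) (≡.trans (≡.sym (LP.map-∘ _)) (≡.trans (≡.sym (LP.map-∘ _))
              (≡.trans (LP.map-cong (λ j → ≡.cong (suc j ,_) (stepj j)) (allFin (suc n)))
                       (LP.map-∘ (allFin (suc n)))))) ⟩
      (zero , map suc (allFin (suc n))) ∷ map (λ j → j , map (punchIn j) (allFin (suc n))) (map suc (allFin (suc n)))
        ≡⟨ ≡.cong (_∷ map (λ j → j , map (punchIn j) (allFin (suc n))) (map suc (allFin (suc n)))) (≡.cong (zero ,_) (LP.map-cong (λ _ → ≡.refl) (allFin (suc n)))) ⟩
      map (λ j → j , map (punchIn j) (allFin (suc n))) (zero ∷ map suc (allFin (suc n)))
        ≡⟨ ≡.cong (map _) (≡.sym (allFin-suc (suc n))) ⟩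
      map (λ j → j , map (punchIn j) (allFin (suc n))) (allFin (suc (suc n))) ∎
    where
    open ≡.≡-Reasoning
    stepj : ∀ j → zero ∷ map suc (map (punchIn j) (allFin n)) ≡ map (punchIn (suc j)) (allFin (suc n))
    stepj j = ≡.trans (≡.cong (zero ∷_) (≡.trans (≡.sym (LP.map-∘ (allFin n))) (LP.map-∘ (allFin n))))
                      (≡.cong (map (punchIn (suc j))) (≡.sym (allFin-suc n)))

  module Laplace {c ℓ} (F : CommutativeRing c ℓ) where
    open CommutativeRing F hiding (zero)
    open import Relation.Binary.Reasoning.Setoid setoid
    open Sums F

    module _ {v} {V : Set v} where
      -- The determinant of the submatrix with rows rs and columns cs (in list order), expanded
      -- along its first row; `selections cs` pairs each column with the remaining ones.
      minor : (V → V → Carrier) → List V → List V → Carrier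
      minor M [] cs = 1#
      minor M (r ∷ rs) cs = altSum (map (λ p → M r (proj₁ p) * minor M rs (proj₂ p)) (selections cs))

      rowExpansion : (V → V → Carrier) → V → (List V → Carrier) → List V → Carrier
      rowExpansion M b h cs = altSum (map (λ p → M b (proj₁ p) * h (proj₂ p)) (selections cs))

      rowExpansion-cons : ∀ M b h c cs → rowExpansion M b h (c ∷ cs) ≈ M b c * h cs - rowExpansion M b (λ C → h (c ∷ C)) cs
      rowExpansion-cons M b h c cs = +-congˡ (-‿cong (reflexive (≡.cong altSum (≡.sym (LP.map-∘ (selections cs))))))

      rowExpansion-cong : ∀ M b {h g} cs → (∀ C → h C ≈ g C) → rowExpansion M b h cs ≈ rowExpansion M b g cs
      rowExpansion-cong M b cs e = alt-cong (selections cs) (λ p → *-congˡ (e (proj₂ p)))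

      rowExpansion-linear : ∀ M b k h g cs → rowExpansion M b (λ C → k * h C - g C) cs ≈ k * rowExpansion M b h cs - rowExpansion M b g cs
      rowExpansion-linear M b k h g cs = begin
        rowExpansion M b (λ C → k * h C - g C) cs
          ≈⟨ alt-cong (selections cs) (λ p → solve 4 (λ m k h g → m :* (k :* h :- g) := k :* (m :* h) :- m :* g) refl (M b (proj₁ p)) k (h (proj₂ p)) (g (proj₂ p))) ⟩
        altSum (map (λ p → k * (M b (proj₁ p) * h (proj₂ p)) - M b (proj₁ p) * g (proj₂ p)) (selections cs))
          ≈⟨ alt-sub _ _ (selections cs) ⟩
        altSum (map (λ p → k * (M b (proj₁ p) * h (proj₂ p))) (selections cs)) - rowExpansion M b g cs
          ≈⟨ +-congʳ (alt-scale k _ (selections cs)) ⟩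
        k * rowExpansion M b h cs - rowExpansion M b g cs ∎

      rowExpansion-neg : ∀ M b h cs → rowExpansion M b (λ C → - h C) cs ≈ - rowExpansion M b h cs
      rowExpansion-neg M b h cs = trans (alt-cong (selections cs) (λ p → sym (-‿distribʳ-* _ _))) (alt-neg _ (selections cs))

      rowExpansion-swap : ∀ M a b h cs → rowExpansion M a (rowExpansion M b h) cs ≈ - rowExpansion M b (rowExpansion M a h) cs
      rowExpansion-swap M a b h [] = sym (-0#≈0#)
      rowExpansion-swap M a b h (c ∷ cs) = begin
        rowExpansion M a (rowExpansion M b h) (c ∷ cs)
          ≈⟨ rowExpansion-cons M a _ c cs ⟩
        M a c * rowExpansion M b h cs - rowExpansion M a (λ C → rowExpansion M b h (c ∷ C)) cs
          ≈⟨ +-congˡ (-‿cong (rowExpansion-cong M a cs (λ C → rowExpansion-cons M b h c C))) ⟩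
        M a c * rowExpansion M b h cs - rowExpansion M a (λ C → M b c * h C - rowExpansion M b h' C) cs
          ≈⟨ +-congˡ (-‿cong (rowExpansion-linear M a (M b c) h (rowExpansion M b h') cs)) ⟩
        M a c * rowExpansion M b h cs - (M b c * rowExpansion M a h cs - rowExpansion M a (rowExpansion M b h') cs)
          ≈⟨ +-congˡ (-‿cong (+-congˡ (-‿cong (rowExpansion-swap M a b h' cs)))) ⟩
        M a c * rowExpansion M b h cs - (M b c * rowExpansion M a h cs - - rowExpansion M b (rowExpansion M a h') cs)
          ≈⟨ solve 5 (λ x y z w u → x :- (y :- :- u) := :- (y :- (x :- u))) refl (M a c * rowExpansion M b h cs) (M b c * rowExpansion M a h cs) 0# 0# (rowExpansion M b (rowExpansion M a h') cs) ⟩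
        - (M b c * rowExpansion M a h cs - (M a c * rowExpansion M b h cs - rowExpansion M b (rowExpansion M a h') cs))
          ≈⟨ -‿cong (+-congˡ (-‿cong (sym (rowExpansion-linear M b (M a c) h (rowExpansion M a h') cs)))) ⟩
        - (M b c * rowExpansion M a h cs - rowExpansion M b (λ C → M a c * h C - rowExpansion M a h' C) cs)
          ≈⟨ -‿cong (+-congˡ (-‿cong (rowExpansion-cong M b cs (λ C → sym (rowExpansion-cons M a h c C))))) ⟩
        - (M b c * rowExpansion M a h cs - rowExpansion M b (λ C → rowExpansion M a h (c ∷ C)) cs)
          ≈⟨ -‿cong (sym (rowExpansion-cons M b _ c cs)) ⟩
        - rowExpansion M b (rowExpansion M a h) (c ∷ cs) ∎
        where h' = λ C → h (c ∷ C)

      minor-swapRows : ∀ M pre a b R C → minor M (pre ++ a ∷ b ∷ R) C ≈ - minor M (pre ++ b ∷ a ∷ R) C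
      minor-swapRows M [] a b R C = rowExpansion-swap M a b (minor M R) C
      minor-swapRows M (p ∷ pre) a b R C =
        trans (rowExpansion-cong M p C (λ C1 → minor-swapRows M pre a b R C1)) (rowExpansion-neg M p _ C)

      altSum-selections-moveRow : ∀ M pre rs (G : V → List V → Carrier) (cols : V → List V → List V) →
        altSum (map (λ p → G (proj₁ p) (proj₂ p) * minor M (pre ++ rs) (cols (proj₁ p) (proj₂ p))) (selections rs))
        ≈ ∑ (map (λ p → G (proj₁ p) (proj₂ p) * minor M (pre ++ proj₁ p ∷ proj₂ p) (cols (proj₁ p) (proj₂ p))) (selections rs))
      altSum-selections-moveRow M pre [] G cols = refl
      altSum-selections-moveRow M pre (r ∷ rs) G cols = +-cong refl (begin
        - altSum (map (λ p → G (proj₁ p) (proj₂ p) * minor M (pre ++ r ∷ rs) (cols (proj₁ p) (proj₂ p))) (map h (selections rs)))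
          ≡⟨ ≡.cong (λ z → - altSum z) (≡.sym (LP.map-∘ (selections rs))) ⟩
        - altSum (map (λ p → G' (proj₁ p) (proj₂ p) * minor M (pre ++ r ∷ rs) (cols' (proj₁ p) (proj₂ p))) (selections rs))
          ≡⟨ ≡.cong (λ X → - altSum (map (λ p → G' (proj₁ p) (proj₂ p) * minor M X (cols' (proj₁ p) (proj₂ p))) (selections rs))) (≡.sym (LP.++-assoc pre [ r ] rs)) ⟩
        - altSum (map (λ p → G' (proj₁ p) (proj₂ p) * minor M ((pre ++ [ r ]) ++ rs) (cols' (proj₁ p) (proj₂ p))) (selections rs))
          ≈⟨ -‿cong (altSum-selections-moveRow M (pre ++ [ r ]) rs G' cols') ⟩
        - ∑ (map (λ p → G' (proj₁ p) (proj₂ p) * minor M ((pre ++ [ r ]) ++ proj₁ p ∷ proj₂ p) (cols' (proj₁ p) (proj₂ p))) (selections rs))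
          ≈⟨ sym (sum-neg _ (selections rs)) ⟩
        ∑ (map (λ p → - (G' (proj₁ p) (proj₂ p) * minor M ((pre ++ [ r ]) ++ proj₁ p ∷ proj₂ p) (cols' (proj₁ p) (proj₂ p)))) (selections rs))
          ≈⟨ sum-cong (selections rs) (λ p → stp p) ⟩
        ∑ (map (λ p → G' (proj₁ p) (proj₂ p) * minor M (pre ++ proj₁ p ∷ r ∷ proj₂ p) (cols' (proj₁ p) (proj₂ p))) (selections rs))
          ≡⟨ ≡.cong ∑ (LP.map-∘ (selections rs)) ⟩
        ∑ (map (λ p → G (proj₁ p) (proj₂ p) * minor M (pre ++ proj₁ p ∷ proj₂ p) (cols (proj₁ p) (proj₂ p))) (map h (selections rs))) ∎)
        where
        h : V × List V → V × List V
        h p = proj₁ p , r ∷ proj₂ p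
        G' = λ t T → G t (r ∷ T)
        cols' = λ t T → cols t (r ∷ T)
        stp : ∀ p → - (G' (proj₁ p) (proj₂ p) * minor M ((pre ++ [ r ]) ++ proj₁ p ∷ proj₂ p) (cols' (proj₁ p) (proj₂ p)))
                   ≈ G' (proj₁ p) (proj₂ p) * minor M (pre ++ proj₁ p ∷ r ∷ proj₂ p) (cols' (proj₁ p) (proj₂ p))
        stp p = begin
          - (G' (proj₁ p) (proj₂ p) * minor M ((pre ++ [ r ]) ++ proj₁ p ∷ proj₂ p) (cols' (proj₁ p) (proj₂ p)))
            ≡⟨ ≡.cong (λ X → - (G' (proj₁ p) (proj₂ p) * minor M X (cols' (proj₁ p) (proj₂ p)))) (LP.++-assoc pre [ r ] _) ⟩
          - (G' (proj₁ p) (proj₂ p) * minor M (pre ++ r ∷ proj₁ p ∷ proj₂ p) (cols' (proj₁ p) (proj₂ p)))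
            ≈⟨ -‿cong (*-congˡ (minor-swapRows M pre r (proj₁ p) (proj₂ p) _)) ⟩
          - (G' (proj₁ p) (proj₂ p) * - minor M (pre ++ proj₁ p ∷ r ∷ proj₂ p) (cols' (proj₁ p) (proj₂ p)))
            ≈⟨ solve 2 (λ a b → :- (a :* :- b) := a :* b) refl _ _ ⟩
          G' (proj₁ p) (proj₂ p) * minor M (pre ++ proj₁ p ∷ r ∷ proj₂ p) (cols' (proj₁ p) (proj₂ p)) ∎

      minor-bordered : ∀ M u w T → minor M (u ∷ T) (w ∷ T) ≈
        M u w * minor M T T - ∑ (map (λ p → M u (proj₁ p) * minor M (proj₁ p ∷ proj₂ p) (w ∷ proj₂ p)) (selections T))
      minor-bordered M u w T = begin
        minor M (u ∷ T) (w ∷ T) ≈⟨ rowExpansion-cons M u (minor M T) w T ⟩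
        M u w * minor M T T - rowExpansion M u (λ C → minor M T (w ∷ C)) T
          ≈⟨ +-congˡ (-‿cong (altSum-selections-moveRow M [] T (λ t _ → M u t) (λ _ T' → w ∷ T'))) ⟩
        M u w * minor M T T - ∑ (map (λ p → M u (proj₁ p) * minor M (proj₁ p ∷ proj₂ p) (w ∷ proj₂ p)) (selections T)) ∎

    minor-map : ∀ {v w} {V : Set v} {W : Set w} (M : W → W → Carrier) (f g : V → W) rs cs →
      minor (λ i k → M (f i) (g k)) rs cs ≈ minor M (map f rs) (map g cs)
    minor-map M f g [] cs = refl
    minor-map M f g (r ∷ rs) cs = begin
      altSum (map (λ p → M (f r) (g (proj₁ p)) * minor (λ i k → M (f i) (g k)) rs (proj₂ p)) (selections cs))
        ≈⟨ alt-cong (selections cs) (λ p → *-congˡ (minor-map M f g rs (proj₂ p))) ⟩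
      altSum (map (λ p → M (f r) (g (proj₁ p)) * minor M (map f rs) (map g (proj₂ p))) (selections cs))
        ≡⟨ ≡.cong altSum (LP.map-∘ (selections cs)) ⟩
      altSum (map (λ q → M (f r) (proj₁ q) * minor M (map f rs) (proj₂ q)) (map (λ p → g (proj₁ p) , map g (proj₂ p)) (selections cs)))
        ≡⟨ ≡.cong (λ z → altSum (map (λ q → M (f r) (proj₁ q) * minor M (map f rs) (proj₂ q)) z)) (≡.sym (selections-map g cs)) ⟩
      altSum (map (λ q → M (f r) (proj₁ q) * minor M (map f rs) (proj₂ q)) (selections (map g cs))) ∎

    altSum-allFin : ∀ n (h : Fin n → Carrier) → altSum (map h (allFin n)) ≈ ∑ (map (λ j → negOnePow F (toℕ j) * h j) (allFin n))
    altSum-allFin zero h = refl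
    altSum-allFin (suc n) h = begin
      altSum (map h (allFin (suc n))) ≡⟨ ≡.cong (λ z → altSum (map h z)) (allFin-suc n) ⟩
      h zero - altSum (map h (map suc (allFin n))) ≡⟨ ≡.cong (λ z → h zero - altSum z) (≡.sym (LP.map-∘ (allFin n))) ⟩
      h zero - altSum (map (λ j → h (suc j)) (allFin n)) ≈⟨ +-congˡ (-‿cong (altSum-allFin n (λ j → h (suc j)))) ⟩
      h zero - ∑ (map (λ j → negOnePow F (toℕ j) * h (suc j)) (allFin n)) ≈⟨ +-cong (sym (*-identityˡ _)) (sym (sum-neg _ (allFin n))) ⟩
      1# * h zero + ∑ (map (λ j → - (negOnePow F (toℕ j) * h (suc j))) (allFin n))
        ≈⟨ +-congˡ (sum-cong (allFin n) (λ j → -‿distribˡ-* _ _)) ⟩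
      1# * h zero + ∑ (map (λ j → negOnePow F (toℕ (suc j)) * h (suc j)) (allFin n))
        ≡⟨ ≡.cong (λ z → 1# * h zero + ∑ z) (LP.map-∘ (allFin n)) ⟩
      ∑ (map (λ j → negOnePow F (toℕ j) * h j) (zero ∷ map suc (allFin n)))
        ≡⟨ ≡.cong (λ z → ∑ (map (λ j → negOnePow F (toℕ j) * h j) z)) (≡.sym (allFin-suc n)) ⟩
      ∑ (map (λ j → negOnePow F (toℕ j) * h j) (allFin (suc n))) ∎

    det≈minor : ∀ n (B : Fin n → Fin n → Carrier) → det F n B ≈ minor B (allFin n) (allFin n)
    det≈minor zero B = refl
    det≈minor (suc n) B = begin
      ∑ (map (λ j → negOnePow F (toℕ j) * B zero j * det F n (λ i k → B (suc i) (punchIn j k))) (allFin (suc n)))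
        ≈⟨ sum-cong (allFin (suc n)) (λ j → trans (*-assoc _ _ _) (*-congˡ (*-congˡ (trans (det≈minor n _) (minor-map B suc (punchIn j) (allFin n) (allFin n)))))) ⟩
      ∑ (map (λ j → negOnePow F (toℕ j) * (B zero j * minor B (map suc (allFin n)) (map (punchIn j) (allFin n)))) (allFin (suc n)))
        ≈⟨ sym (altSum-allFin (suc n) _) ⟩
      altSum (map (λ j → B zero j * minor B (map suc (allFin n)) (map (punchIn j) (allFin n))) (allFin (suc n)))
        ≡⟨ ≡.cong altSum (LP.map-∘ (allFin (suc n))) ⟩
      altSum (map (λ p → B zero (proj₁ p) * minor B (map suc (allFin n)) (proj₂ p)) (map (λ j → j , map (punchIn j) (allFin n)) (allFin (suc n))))
        ≡⟨ ≡.cong (λ z → altSum (map (λ p → B zero (proj₁ p) * minor B (map suc (allFin n)) (proj₂ p)) z)) (≡.sym (selections-allFin n)) ⟩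
      minor B (zero ∷ map suc (allFin n)) (allFin (suc n))
        ≡⟨ ≡.cong (λ z → minor B z (allFin (suc n))) (≡.sym (allFin-suc n)) ⟩
      minor B (allFin (suc n)) (allFin (suc n)) ∎


module MinorExpansion where

  open import Algebra.Bundles using (CommutativeRing)
  open import Data.Bool using (Bool; true; false; if_then_else_; not; _∧_; _∨_)
  open import Data.Nat using (ℕ; zero; suc; _<_)
  import Data.Nat.Properties as NP
  open import Data.Fin using (Fin; zero; suc)
  open import Data.List using (List; []; _∷_; map; allFin; filterᵇ; length; concatMap; upTo)
  open import Data.Bool.ListAction using (all)
  import Data.List.Properties as LP
  open import Data.List.Membership.Propositional using (_∈_)
  open import Data.List.Relation.Unary.All as All using (All; []; _∷_)
  open import Data.List.Relation.Unary.AllPairs using ([]; _∷_)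
  open import Data.List.Relation.Unary.Unique.Propositional using (Unique)
  open import Data.List.Relation.Unary.Unique.Propositional.Properties using (allFin⁺)
  open import Data.List.Membership.Propositional.Properties using (∈-allFin)
  open import Data.Product using (_,_; proj₁; proj₂)
  open import Relation.Binary.PropositionalEquality as ≡ using (_≡_)
  open import Defs
  open Summation
  open FinBool
  open ListBool using (∧-identityʳ)
  open ListDeterminant

  module ForMatrix {c ℓ} (F : CommutativeRing c ℓ) {N : ℕ} (M : Fin N → Fin N → CommutativeRing.Carrier F) where
    open CommutativeRing F hiding (zero)
    open import Relation.Binary.Reasoning.Setoid setoid
    open Sums F
    open Laplace F

    principalMinor : List (Fin N) → Carrier
    principalMinor T = minor M T T

    borderedMinor : Fin N → Fin N → List (Fin N) → Carrier
    borderedMinor w u T = minor M (u ∷ T) (w ∷ T)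

    vertices : (Fin N → Bool) → List (Fin N)
    vertices p = filterᵇ p (allFin N)

    without : (Fin N → Bool) → Fin N → Fin N → Bool
    without p t w = p w ∧ not (w == t)

    sum-selections-filter : ∀ (xs : List (Fin N)) → Unique xs → ∀ (p : Fin N → Bool) (H : Fin N → List (Fin N) → Carrier) →
      ∑ (map (λ q → H (proj₁ q) (proj₂ q)) (selections (filterᵇ p xs)))
      ≈ ∑ (map (λ t → if p t then H t (filterᵇ (without p t) xs) else 0#) xs)
    sum-selections-filter [] _ p H = refl
    sum-selections-filter (y ∷ ys) (y∉ ∷ uys) p H = cases (p y) ≡.refl
      where
      cases : ∀ b → p y ≡ b → ∑ (map (λ q → H (proj₁ q) (proj₂ q)) (selections (filterᵇ p (y ∷ ys))))
        ≈ ∑ (map (λ t → if p t then H t (filterᵇ (without p t) (y ∷ ys)) else 0#) (y ∷ ys))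
      cases true py = begin
        ∑ (map (λ q → H (proj₁ q) (proj₂ q)) (selections (filterᵇ p (y ∷ ys))))
          ≡⟨ ≡.cong (λ z → ∑ (map (λ q → H (proj₁ q) (proj₂ q)) (selections z))) (filter-true p y ys py) ⟩
        H y (filterᵇ p ys) + ∑ (map (λ q → H (proj₁ q) (proj₂ q)) (map (λ q → proj₁ q , y ∷ proj₂ q) (selections (filterᵇ p ys))))
          ≡⟨ ≡.cong (λ z → H y (filterᵇ p ys) + ∑ z) (≡.sym (LP.map-∘ (selections (filterᵇ p ys)))) ⟩
        H y (filterᵇ p ys) + ∑ (map (λ q → H (proj₁ q) (y ∷ proj₂ q)) (selections (filterᵇ p ys)))
          ≈⟨ +-congˡ (sum-selections-filter ys uys p (λ t T → H t (y ∷ T))) ⟩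
        H y (filterᵇ p ys) + ∑ (map (λ t → if p t then H t (y ∷ filterᵇ (without p t) ys) else 0#) ys)
          ≈⟨ +-cong (reflexive (≡.cong (H y) e1)) (sum-cong-∈ ys (λ t m → reflexive (≡.cong (λ z → if p t then H t z else 0#) (≡.sym (e2 t m))))) ⟩
        H y (filterᵇ (without p y) (y ∷ ys)) + ∑ (map (λ t → if p t then H t (filterᵇ (without p t) (y ∷ ys)) else 0#) ys)
          ≡⟨ ≡.cong (λ b → (if b then H y (filterᵇ (without p y) (y ∷ ys)) else 0#) + ∑ (map (λ t → if p t then H t (filterᵇ (without p t) (y ∷ ys)) else 0#) ys)) (≡.sym py) ⟩
        ∑ (map (λ t → if p t then H t (filterᵇ (without p t) (y ∷ ys)) else 0#) (y ∷ ys)) ∎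
        where
        e1 : filterᵇ p ys ≡ filterᵇ (without p y) (y ∷ ys)
        e1 = ≡.sym (≡.trans (filter-false _ y ys (≡.cong₂ (λ a b → a ∧ not b) py (==-refl y)))
               (filter-cong∈ ys (λ w m → ≡.trans (≡.cong (λ b → p w ∧ not b) (==-false w y (λ eq → All.lookup y∉ m (≡.sym eq)))) (∧-identityʳ (p w)))))
        e2 : ∀ t → t ∈ ys → filterᵇ (without p t) (y ∷ ys) ≡ y ∷ filterᵇ (without p t) ys
        e2 t m = filter-true _ y ys (≡.cong₂ (λ a b → a ∧ not b) py (==-false y t (All.lookup y∉ m)))
      cases false py = begin
        ∑ (map (λ q → H (proj₁ q) (proj₂ q)) (selections (filterᵇ p (y ∷ ys))))
          ≡⟨ ≡.cong (λ z → ∑ (map (λ q → H (proj₁ q) (proj₂ q)) (selections z))) (filter-false p y ys py) ⟩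
        ∑ (map (λ q → H (proj₁ q) (proj₂ q)) (selections (filterᵇ p ys)))
          ≈⟨ sum-selections-filter ys uys p H ⟩
        ∑ (map (λ t → if p t then H t (filterᵇ (without p t) ys) else 0#) ys)
          ≈⟨ sum-cong-∈ ys (λ t m → reflexive (≡.cong (λ z → if p t then H t z else 0#) (≡.sym (filter-false _ y ys (≡.cong (λ a → a ∧ not (y == t)) py))))) ⟩
        ∑ (map (λ t → if p t then H t (filterᵇ (without p t) (y ∷ ys)) else 0#) ys)
          ≈⟨ sym (+-identityˡ _) ⟩
        0# + ∑ (map (λ t → if p t then H t (filterᵇ (without p t) (y ∷ ys)) else 0#) ys)
          ≡⟨ ≡.cong (λ b → (if b then H y (filterᵇ (without p y) (y ∷ ys)) else 0#) + ∑ (map (λ t → if p t then H t (filterᵇ (without p t) (y ∷ ys)) else 0#) ys)) (≡.sym py) ⟩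
        ∑ (map (λ t → if p t then H t (filterᵇ (without p t) (y ∷ ys)) else 0#) (y ∷ ys)) ∎

    walkProduct : Fin N → List (Fin N) → Fin N → Carrier
    walkProduct u [] w = M u w
    walkProduct u (t ∷ s) w = M u t * walkProduct t s w

    avoiding : (Fin N → Bool) → List (Fin N) → Fin N → Bool
    avoiding p s w = p w ∧ not (elemᵇ w s)

    walkTerm : Fin N → Fin N → (Fin N → Bool) → ℕ → List (Fin N) → Carrier
    walkTerm v u p k s = if distinctᵇ s ∧ all p s then negOnePow F k * walkProduct u s v * principalMinor (vertices (avoiding p s)) else 0#

    walkSum : Fin N → Fin N → (Fin N → Bool) → ℕ → Carrier
    walkSum v u p k = ∑ (map (walkTerm v u p k) (listsOfLength N k))

    walkTerm-cons : ∀ v u p k t s → walkTerm v u p (suc k) (t ∷ s) ≈ (if p t then - (M u t * walkTerm v t (without p t) k s) else 0#)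
    walkTerm-cons v u p k t s = begin
      walkTerm v u p (suc k) (t ∷ s)
        ≡⟨ ≡.cong₂ (λ b z → if b then negOnePow F (suc k) * (M u t * walkProduct t s v) * principalMinor z else 0#) boolEq flEq ⟩
      (if p t ∧ (distinctᵇ s ∧ all (without p t) s) then (- negOnePow F k) * (M u t * walkProduct t s v) * principalMinor (vertices (avoiding (without p t) s)) else 0#)
        ≈⟨ guarded-scale (p t) (distinctᵇ s ∧ all (without p t) s) ⟩
      (if p t then - (M u t * walkTerm v t (without p t) k s) else 0#) ∎
      where
      reorder : ∀ e d a c → ((not e ∧ d) ∧ (a ∧ c)) ≡ (a ∧ (d ∧ (c ∧ not e)))
      reorder true d a c = ≡.sym (lem a d c)
        where lem : ∀ a d c → (a ∧ (d ∧ (c ∧ false))) ≡ false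
              lem false d c = ≡.refl
              lem true false c = ≡.refl
              lem true true false = ≡.refl
              lem true true true = ≡.refl
      reorder false true true c = ≡.sym (∧-identityʳ c)
      reorder false true false c = ≡.refl
      reorder false false false c = ≡.refl
      reorder false false true c = ≡.refl
      boolEq : (distinctᵇ (t ∷ s) ∧ all p (t ∷ s)) ≡ (p t ∧ (distinctᵇ s ∧ all (without p t) s))
      boolEq = ≡.trans (reorder (elemᵇ t s) (distinctᵇ s) (p t) (all p s))
                       (≡.cong (λ z → p t ∧ (distinctᵇ s ∧ z)) (≡.sym (all-∧-not p t s)))
      flEq : vertices (avoiding p (t ∷ s)) ≡ vertices (avoiding (without p t) s)
      flEq = filter-cong (allFin N) (λ w → ≡.trans (≡.cong (λ z → p w ∧ not (z ∨ elemᵇ w s)) (==-sym t w)) (bl2 (p w) (w == t) (elemᵇ w s)))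
        where bl2 : ∀ a b c → (a ∧ not (b ∨ c)) ≡ ((a ∧ not b) ∧ not c)
              bl2 true true c = ≡.refl
              bl2 true false c = ≡.refl
              bl2 false b c = ≡.refl
      guarded-scale : ∀ a b → (if a ∧ b then (- negOnePow F k) * (M u t * walkProduct t s v) * principalMinor (vertices (avoiding (without p t) s)) else 0#)
                  ≈ (if a then - (M u t * (if b then negOnePow F k * walkProduct t s v * principalMinor (vertices (avoiding (without p t) s)) else 0#)) else 0#)
      guarded-scale false b = refl
      guarded-scale true true = solve 4 (λ a b c d → (:- a) :* (b :* c) :* d := :- (b :* (a :* c :* d))) refl _ _ _ _
      guarded-scale true false = sym (trans (-‿cong (zeroʳ _)) (-0#≈0#))

    walkSum-suc : ∀ v u p k → walkSum v u p (suc k) ≈ ∑ (map (λ t → if p t then - (M u t * walkSum v t (without p t) k) else 0#) (allFin N))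
    walkSum-suc v u p k = begin
      ∑ (map (walkTerm v u p (suc k)) (concatMap (λ t → map (t ∷_) (listsOfLength N k)) (allFin N)))
        ≈⟨ sum-concatMap _ _ (allFin N) ⟩
      ∑ (map (λ t → ∑ (map (walkTerm v u p (suc k)) (map (t ∷_) (listsOfLength N k)))) (allFin N))
        ≈⟨ sum-cong (allFin N) (λ t → reflexive (≡.cong ∑ (≡.sym (LP.map-∘ (listsOfLength N k))))) ⟩
      ∑ (map (λ t → ∑ (map (λ s → walkTerm v u p (suc k) (t ∷ s)) (listsOfLength N k))) (allFin N))
        ≈⟨ sum-cong (allFin N) (λ t → sum-cong (listsOfLength N k) (λ s → walkTerm-cons v u p k t s)) ⟩
      ∑ (map (λ t → ∑ (map (λ s → if p t then - (M u t * walkTerm v t (without p t) k s) else 0#) (listsOfLength N k))) (allFin N))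
        ≈⟨ sum-cong (allFin N) (λ t → sum-if (p t) _ (listsOfLength N k)) ⟩
      ∑ (map (λ t → if p t then ∑ (map (λ s → - (M u t * walkTerm v t (without p t) k s)) (listsOfLength N k)) else 0#) (allFin N))
        ≈⟨ sum-cong (allFin N) (λ t → if-cong (p t) (λ _ → trans (sum-neg _ (listsOfLength N k)) (-‿cong (sum-scale _ _ (listsOfLength N k))))) ⟩
      ∑ (map (λ t → if p t then - (M u t * walkSum v t (without p t) k) else 0#) (allFin N)) ∎

    borderedMinor≈∑walkSum : ∀ K v u p → length (vertices p) < K → borderedMinor v u (vertices p) ≈ ∑ (map (walkSum v u p) (upTo K))
    borderedMinor≈∑walkSum (suc K) v u p lt = begin
      borderedMinor v u (vertices p)
        ≈⟨ minor-bordered M u v (vertices p) ⟩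
      M u v * principalMinor (vertices p) - ∑ (map (λ q → M u (proj₁ q) * borderedMinor v (proj₁ q) (proj₂ q)) (selections (vertices p)))
        ≈⟨ +-congˡ (-‿cong (sum-selections-filter (allFin N) (allFin⁺ N) p (λ t T → M u t * borderedMinor v t T))) ⟩
      M u v * principalMinor (vertices p) - ∑ (map (λ t → if p t then M u t * borderedMinor v t (vertices (without p t)) else 0#) (allFin N))
        ≈⟨ +-congˡ (-‿cong (sum-cong (allFin N) (λ t → if-cong (p t) (λ pt → *-congˡ (borderedMinor≈∑walkSum K v t (without p t) (lenlt t pt)))))) ⟩
      M u v * principalMinor (vertices p) - ∑ (map (λ t → if p t then M u t * ∑ (map (walkSum v t (without p t)) (upTo K)) else 0#) (allFin N))
        ≈⟨ +-cong (sym walkSum₀) (trans (sym (sum-neg _ (allFin N))) (sum-cong (allFin N) (λ t → if-neg (p t) _))) ⟩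
      walkSum v u p 0 + ∑ (map (λ t → if p t then - (M u t * ∑ (map (walkSum v t (without p t)) (upTo K))) else 0#) (allFin N))
        ≈⟨ +-congˡ (sym rest) ⟩
      walkSum v u p 0 + ∑ (map (λ k → walkSum v u p (suc k)) (upTo K))
        ≡⟨ ≡.cong (λ z → walkSum v u p 0 + ∑ z) (LP.map-∘ (upTo K)) ⟩
      ∑ (map (walkSum v u p) (0 ∷ map suc (upTo K)))
        ≡⟨ ≡.cong (λ z → ∑ (map (walkSum v u p) z)) (≡.sym (upTo-suc K)) ⟩
      ∑ (map (walkSum v u p) (upTo (suc K))) ∎
      where
      lenlt : ∀ t → p t ≡ true → length (vertices (without p t)) < K
      lenlt t pt = NP.<-≤-trans (length-filter-mono-< p (without p t) (λ x e → proj₁ (∧-true e)) (allFin N) t (∈-allFin t) pt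
                       (≡.cong₂ (λ a b → a ∧ not b) pt (==-refl t)))
                     (NP.≤-pred lt)
      walkSum₀ : walkSum v u p 0 ≈ M u v * principalMinor (vertices p)
      walkSum₀ = trans (+-identityʳ _) (trans (*-congʳ (*-identityˡ _)) (*-congˡ (reflexive (≡.cong principalMinor (filter-cong (allFin N) (λ w → ∧-identityʳ (p w)))))))
      rest : ∑ (map (λ k → walkSum v u p (suc k)) (upTo K)) ≈ ∑ (map (λ t → if p t then - (M u t * ∑ (map (walkSum v t (without p t)) (upTo K))) else 0#) (allFin N))
      rest = begin
        ∑ (map (λ k → walkSum v u p (suc k)) (upTo K))
          ≈⟨ sum-cong (upTo K) (λ k → walkSum-suc v u p k) ⟩
        ∑ (map (λ k → ∑ (map (λ t → if p t then - (M u t * walkSum v t (without p t) k) else 0#) (allFin N))) (upTo K))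
          ≈⟨ sum-swap (λ k t → if p t then - (M u t * walkSum v t (without p t) k) else 0#) (upTo K) (allFin N) ⟩
        ∑ (map (λ t → ∑ (map (λ k → if p t then - (M u t * walkSum v t (without p t) k) else 0#) (upTo K))) (allFin N))
          ≈⟨ sum-cong (allFin N) (λ t → trans (sum-if (p t) _ (upTo K)) (if-cong (p t) (λ _ → trans (sum-neg _ (upTo K)) (-‿cong (sum-scale _ _ (upTo K)))))) ⟩
        ∑ (map (λ t → if p t then - (M u t * ∑ (map (walkSum v t (without p t)) (upTo K))) else 0#) (allFin N)) ∎


module ComponentSums where

  open import Algebra.Bundles using (CommutativeRing)
  open import Data.Bool using (Bool; true; false; if_then_else_; not; _∧_; _∨_)
  open import Data.Nat using (ℕ; zero; suc)
  open import Data.Fin using (Fin; zero; suc)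
  open import Data.List using (List; []; _∷_; _++_; [_]; map; allFin; filterᵇ; length)
  open import Data.Bool.ListAction using (any)
  import Data.List.Properties as LP
  open import Data.List.Membership.Propositional using (_∈_)
  open import Data.List.Relation.Unary.Any using (here; there)
  open import Data.List.Relation.Unary.All as All using (All; []; _∷_)
  open import Data.List.Relation.Unary.AllPairs using ([]; _∷_)
  open import Data.List.Relation.Unary.Unique.Propositional using (Unique)
  open import Data.List.Relation.Unary.Unique.Propositional.Properties using (allFin⁺)
  open import Data.List.Membership.Propositional.Properties using (∈-allFin)
  open import Data.Product using (Σ; proj₁; proj₂)
  open import Relation.Binary.PropositionalEquality as ≡ using (_≡_)
  open import Function using (_∘_)
  import Data.Integer as ℤ
  open import Relation.Nullary.Decidable using (T?)
  open import Defs
  open Summation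
  open FinBool
  open ListBool

  module Products {c ℓ} (F : CommutativeRing c ℓ) where
    open CommutativeRing F hiding (zero)
    open import Relation.Binary.Reasoning.Setoid setoid
    open Sums F

    ∏ : List Carrier → Carrier
    ∏ = prodL F

    prod-filter-extract : ∀ {n} (h : Fin n → Carrier) (xs : List (Fin n)) → Unique xs → ∀ (p : Fin n → Bool) v → v ∈ xs → p v ≡ true →
      ∏ (map h (filterᵇ p xs)) ≈ h v * ∏ (map h (filterᵇ (λ w → p w ∧ not (w == v)) xs))
    prod-filter-extract h (y ∷ ys) (y∉ ∷ uys) p v (here ≡.refl) pv = begin
      ∏ (map h (filterᵇ p (y ∷ ys))) ≡⟨ ≡.cong (∏ ∘ map h) (filter-true p y ys pv) ⟩
      h y * ∏ (map h (filterᵇ p ys)) ≡⟨ ≡.cong (λ z → h y * ∏ (map h z)) (filter-cong∈ ys (λ w m → ≡.sym (≡.trans (≡.cong (λ b → p w ∧ not b) (==-false w y (λ eq → All.lookup y∉ m (≡.sym eq)))) (∧-identityʳ _)))) ⟩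
      h y * ∏ (map h (filterᵇ (λ w → p w ∧ not (w == y)) ys)) ≡⟨ ≡.cong (λ z → h y * ∏ (map h z)) (≡.sym (filter-false _ y ys (≡.cong₂ (λ a b → a ∧ not b) pv (==-refl y)))) ⟩
      h y * ∏ (map h (filterᵇ (λ w → p w ∧ not (w == y)) (y ∷ ys))) ∎
    prod-filter-extract h (y ∷ ys) (y∉ ∷ uys) p v (there m) pv = cases (p y) ≡.refl
      where
      yv : (y == v) ≡ false
      yv = ==-false y v (All.lookup y∉ m)
      cases : ∀ b → p y ≡ b → ∏ (map h (filterᵇ p (y ∷ ys))) ≈ h v * ∏ (map h (filterᵇ (λ w → p w ∧ not (w == v)) (y ∷ ys)))
      cases true py = begin
        ∏ (map h (filterᵇ p (y ∷ ys))) ≡⟨ ≡.cong (∏ ∘ map h) (filter-true p y ys py) ⟩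
        h y * ∏ (map h (filterᵇ p ys)) ≈⟨ *-congˡ (prod-filter-extract h ys uys p v m pv) ⟩
        h y * (h v * ∏ (map h (filterᵇ (λ w → p w ∧ not (w == v)) ys))) ≈⟨ solve 3 (λ a b c → a :* (b :* c) := b :* (a :* c)) refl _ _ _ ⟩
        h v * (h y * ∏ (map h (filterᵇ (λ w → p w ∧ not (w == v)) ys))) ≡⟨ ≡.cong (λ z → h v * ∏ (map h z)) (≡.sym (filter-true _ y ys (≡.cong₂ (λ a b → a ∧ not b) py yv))) ⟩
        h v * ∏ (map h (filterᵇ (λ w → p w ∧ not (w == v)) (y ∷ ys))) ∎
      cases false py = begin
        ∏ (map h (filterᵇ p (y ∷ ys))) ≡⟨ ≡.cong (∏ ∘ map h) (filter-false p y ys py) ⟩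
        ∏ (map h (filterᵇ p ys)) ≈⟨ prod-filter-extract h ys uys p v m pv ⟩
        h v * ∏ (map h (filterᵇ (λ w → p w ∧ not (w == v)) ys)) ≡⟨ ≡.cong (λ z → h v * ∏ (map h z)) (≡.sym (filter-false _ y ys (≡.cong (λ a → a ∧ not (y == v)) py))) ⟩
        h v * ∏ (map h (filterᵇ (λ w → p w ∧ not (w == v)) (y ∷ ys))) ∎

  module ForGraph {c ℓ} (F : CommutativeRing c ℓ) {N : ℕ} (G : SimpleGraph N)
            (f : CommutativeRing.Carrier F → CommutativeRing.Carrier F)
            (φ : Fin N → Fin N → CommutativeRing.Carrier F) (x : CommutativeRing.Carrier F) where
    open CommutativeRing F hiding (zero)
    open import Relation.Binary.Reasoning.Setoid setoid
    open Sums F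
    open Products F

    verts : Comp G → List (Fin N)
    verts = compVerts G

    diag : Fin N → Carrier
    diag v = x - d F G f φ v

    outsideProduct : (Fin N → Bool) → Carrier
    outsideProduct used = ∏ (map diag (filterᵇ (λ v → not (used v)) (allFin N)))

    evenCount : Comp G → ℕ
    evenCount c = if isEven (length (verts c)) then 1 else 0

    signedWeight : Comp G → Carrier
    signedWeight c = negOnePow F (evenCount c) * compWeight F G f φ c

    fits : (Fin N → Bool) → Comp G → Bool
    fits used c = distinctᵇ (verts c) ∧ not (any used (verts c))

    cover : (Fin N → Bool) → List (Fin N) → Fin N → Bool
    cover used X w = used w ∨ elemᵇ w X

    -- componentSum ok used cs sums, over the sublists L of cs whose components are simple, pairwise
    -- disjoint and avoid `used`, the signed weight of L times the product of x − d(w) over the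
    -- vertices w covered neither by `used` nor by L; the flag ok records that no clash occurred.
    componentSum : Bool → (Fin N → Bool) → List (Comp G) → Carrier
    componentSum ok used [] = if ok then outsideProduct used else 0#
    componentSum ok used (c ∷ cs) = componentSum ok used cs + signedWeight c * componentSum (ok ∧ fits used c) (cover used (verts c)) cs

    componentSum-cong : ∀ {ok ok' used used′} cs → ok ≡ ok' → (∀ w → used w ≡ used′ w) → componentSum ok used cs ≈ componentSum ok' used′ cs
    componentSum-cong {ok} {ok'} {used} {used′} [] ≡.refl e = reflexive (≡.cong (λ z → if ok then ∏ (map diag z) else 0#) (filter-cong (allFin N) (λ w → ≡.cong not (e w))))
    componentSum-cong {ok} {ok'} {used} {used′} (c ∷ cs) ≡.refl e = +-cong (componentSum-cong cs ≡.refl e)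
      (*-congˡ (componentSum-cong cs (≡.cong (λ z → ok ∧ (distinctᵇ (verts c) ∧ not z)) (any-cong (verts c) e)) (λ w → ≡.cong (_∨ elemᵇ w (verts c)) (e w))))

    componentSum-false : ∀ {b} used cs → b ≡ false → componentSum b used cs ≈ 0#
    componentSum-false used [] ≡.refl = refl
    componentSum-false used (c ∷ cs) ≡.refl = trans (+-cong (componentSum-false used cs ≡.refl) (*-congˡ (componentSum-false _ cs ≡.refl)))
      (trans (+-identityˡ _) (zeroʳ _))

    fits-hit : ∀ used c v → elemᵇ v (verts c) ≡ true → used v ≡ true → fits used c ≡ false
    fits-hit used c v e uv rewrite any-elem used v (verts c) e uv = ∧-zeroʳ (distinctᵇ (verts c))

    cover-∋ : ∀ used X v → elemᵇ v X ≡ true → cover used X v ≡ true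
    cover-∋ used X v e = ≡.trans (≡.cong (used v ∨_) e) (∨-zeroʳ (used v))

    cover-[v] : ∀ used v → cover used [ v ] v ≡ true
    cover-[v] used v = cover-∋ used [ v ] v (≡.cong (_∨ false) (==-refl v))

    componentSum-unfit : ∀ ok used c v cs → elemᵇ v (verts c) ≡ true → used v ≡ true →
      componentSum (ok ∧ fits used c) (cover used (verts c)) cs ≈ 0#
    componentSum-unfit ok used c v cs ev uv =
      componentSum-false _ cs (≡.trans (≡.cong (ok ∧_) (fits-hit used c v ev uv)) (∧-zeroʳ ok))

    componentSum-cons-unfit : ∀ ok used c v cs → elemᵇ v (verts c) ≡ true → used v ≡ true →
      componentSum ok used (c ∷ cs) ≈ componentSum ok used cs
    componentSum-cons-unfit ok used c v cs ev uv =
      trans (+-congˡ (trans (*-congˡ (componentSum-unfit ok used c v cs ev uv)) (zeroʳ _))) (+-identityʳ _)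

    componentSum-covered : ∀ ok used cs → (∀ w → used w ≡ true) → (∀ c → c ∈ cs → Σ (Fin N) (λ w → elemᵇ w (verts c) ≡ true)) →
      componentSum ok used cs ≈ componentSum ok used []
    componentSum-covered ok used [] covered nonempty = refl
    componentSum-covered ok used (c ∷ cs) covered nonempty =
      trans (componentSum-cons-unfit ok used c (proj₁ w) cs (proj₂ w) (covered (proj₁ w)))
            (componentSum-covered ok used cs covered (λ c' m → nonempty c' (there m)))
      where w = nonempty c (here ≡.refl)

    componentsThrough : Fin N → Bool → (Fin N → Bool) → List (Comp G) → List (Comp G) → Carrier
    componentsThrough v ok used cs ds = ∑ (map (λ c' → if elemᵇ v (verts c') then signedWeight c' * componentSum (ok ∧ fits used c') (cover used (verts c')) cs else 0#) ds)

    componentsThrough-used : ∀ v ok used cs ds → used v ≡ true → componentsThrough v ok used cs ds ≈ 0#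
    componentsThrough-used v ok used cs ds uv = sum-zero _ ds (λ c' _ → if-zero (elemᵇ v (verts c')) (λ ev →
      trans (*-congˡ (componentSum-unfit ok used c' v cs ev uv)) (zeroʳ _)))

    fits-cover : ∀ used A c → fits (cover used A) c ≡ (distinctᵇ (verts c) ∧ not (any used (verts c) ∨ any (λ w → elemᵇ w A) (verts c)))
    fits-cover used A c = ≡.cong (λ z → distinctᵇ (verts c) ∧ not z) (any-∨ used (λ w → elemᵇ w A) (verts c))

    fits-swap : ∀ ok used c c' → ((ok ∧ fits used c') ∧ fits (cover used (verts c')) c) ≡ ((ok ∧ fits used c) ∧ fits (cover used (verts c)) c')
    fits-swap ok used c c' rewrite fits-cover used (verts c') c | fits-cover used (verts c) c' | disjoint-sym (verts c') (verts c) =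
      lem ok (distinctᵇ (verts c)) (distinctᵇ (verts c')) (any used (verts c)) (any used (verts c')) (any (λ w → elemᵇ w (verts c)) (verts c'))
      where
      lem : ∀ ok a a' i i' t → ((ok ∧ (a' ∧ not i')) ∧ (a ∧ not (i ∨ t))) ≡ ((ok ∧ (a ∧ not i)) ∧ (a' ∧ not (i' ∨ t)))
      lem ok a a' i i' t rewrite not-∨ i t | not-∨ i' t =
        BS.solve 6 (λ o a a' i i' t → (o BS.:* (a' BS.:* i')) BS.:* (a BS.:* (i BS.:* t)) BS.:= (o BS.:* (a BS.:* i)) BS.:* (a' BS.:* (i' BS.:* t))) ≡.refl ok a a' (not i) (not i') (not t)

    cover-comm : ∀ used A B w → cover (cover used A) B w ≡ cover (cover used B) A w
    cover-comm used A B w = BS.solve 3 (λ a b c → (a BS.:+ b) BS.:+ c BS.:= (a BS.:+ c) BS.:+ b) ≡.refl (used w) (elemᵇ w A) (elemᵇ w B)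

    componentsThrough-cons : ∀ v ok used c cs ds →
      componentsThrough v ok used (c ∷ cs) ds ≈
      componentsThrough v ok used cs ds + signedWeight c * componentsThrough v (ok ∧ fits used c) (cover used (verts c)) cs ds
    componentsThrough-cons v ok used c cs ds =
      trans (sum-cong ds (λ c' → trans (if-distrib (elemᵇ v (verts c')) (signedWeight c') _ (signedWeight c) _)
              (+-congˡ (*-congˡ (if-cong (elemᵇ v (verts c')) (λ _ → *-congˡ
                (componentSum-cong cs (fits-swap ok used c c') (cover-comm used (verts c') (verts c)))))))))
            (trans (sum-+ _ _ ds) (+-congˡ (sum-scale (signedWeight c) _ ds)))

    SplitsAt : Fin N → Bool → (Fin N → Bool) → List (Comp G) → Set ℓ
    SplitsAt v ok used cs = componentSum ok used cs ≈ diag v * componentSum ok (cover used [ v ]) cs + componentsThrough v ok used cs cs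

    componentSum-split-[] : ∀ v ok used → used v ≡ false → SplitsAt v ok used []
    componentSum-split-[] v false used uv = sym (trans (+-identityʳ _) (zeroʳ _))
    componentSum-split-[] v true  used uv = sym (trans (+-identityʳ _) (sym (trans
      (prod-filter-extract diag (allFin N) (allFin⁺ N) (λ w → not (used w)) v (∈-allFin v) (≡.cong not uv))
      (*-congˡ (reflexive (≡.cong (∏ ∘ map diag) (filter-cong (allFin N) (λ w → lem (used w) (w == v) (v == w) (==-sym v w)))))))))
      where
      lem : ∀ a b b' → b' ≡ b → (not a ∧ not b) ≡ not (a ∨ (b' ∨ false))
      lem true  b     b'    e = ≡.refl
      lem false true  true  e = ≡.refl
      lem false false false e = ≡.refl

    componentSum-split-∋ : ∀ v ok used c cs → elemᵇ v (verts c) ≡ true → SplitsAt v ok used cs → SplitsAt v ok used (c ∷ cs)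
    componentSum-split-∋ v ok used c cs ev IH = sym (begin
      diag v * componentSum ok usedV (c ∷ cs) + ((if elemᵇ v (verts c) then s * componentSum okC usedC (c ∷ cs) else 0#) + componentsThrough v ok used (c ∷ cs) cs)
        ≈⟨ +-cong (*-congˡ (componentSum-cons-unfit ok usedV c v cs ev (cover-[v] used v)))
                  (+-cong (trans (reflexive (if-true _ ev)) (*-congˡ (componentSum-cons-unfit okC usedC c v cs ev vC)))
                          (trans (componentsThrough-cons v ok used c cs cs) (+-congˡ (*-congˡ (componentsThrough-used v okC usedC cs cs vC))))) ⟩
      diag v * componentSum ok usedV cs + (s * componentSum okC usedC cs + (componentsThrough v ok used cs cs + s * 0#))
        ≈⟨ solve 5 (λ h a s b t → h :* a :+ (s :* b :+ (t :+ s :* con (ℤ.+ 0))) := (h :* a :+ t) :+ s :* b) refl _ _ _ _ _ ⟩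
      (diag v * componentSum ok usedV cs + componentsThrough v ok used cs cs) + s * componentSum okC usedC cs
        ≈⟨ +-congʳ IH ⟨
      componentSum ok used cs + s * componentSum okC usedC cs ∎)
      where
      s = signedWeight c
      usedV = cover used [ v ]
      usedC = cover used (verts c)
      okC = ok ∧ fits used c
      vC : usedC v ≡ true
      vC = cover-∋ used (verts c) v ev

    componentSum-split-∌ : ∀ v ok used c cs → elemᵇ v (verts c) ≡ false → SplitsAt v ok used cs →
      SplitsAt v (ok ∧ fits used c) (cover used (verts c)) cs → SplitsAt v ok used (c ∷ cs)
    componentSum-split-∌ v ok used c cs ev IH IHc = sym (begin
      diag v * (componentSum ok usedV cs + s * componentSum (ok ∧ fits usedV c) (cover usedV (verts c)) cs)
        + ((if elemᵇ v (verts c) then s * componentSum okC usedC (c ∷ cs) else 0#) + componentsThrough v ok used (c ∷ cs) cs)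
        ≈⟨ +-cong (*-congˡ (+-congˡ (*-congˡ (componentSum-cong cs fitsV (cover-comm used [ v ] (verts c))))))
                  (+-cong (reflexive (if-false _ ev)) (componentsThrough-cons v ok used c cs cs)) ⟩
      diag v * (componentSum ok usedV cs + s * componentSum okC (cover usedC [ v ]) cs)
        + (0# + (componentsThrough v ok used cs cs + s * componentsThrough v okC usedC cs cs))
        ≈⟨ solve 6 (λ h a s b t u → h :* (a :+ s :* b) :+ (con (ℤ.+ 0) :+ (t :+ s :* u)) := (h :* a :+ t) :+ s :* (h :* b :+ u)) refl _ _ _ _ _ _ ⟩
      (diag v * componentSum ok usedV cs + componentsThrough v ok used cs cs)
        + s * (diag v * componentSum okC (cover usedC [ v ]) cs + componentsThrough v okC usedC cs cs)
        ≈⟨ +-cong IH (*-congˡ IHc) ⟨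
      componentSum ok used cs + s * componentSum okC usedC cs ∎)
      where
      s = signedWeight c
      usedV = cover used [ v ]
      usedC = cover used (verts c)
      okC = ok ∧ fits used c
      fitsV : (ok ∧ fits usedV c) ≡ okC
      fitsV = ≡.cong (ok ∧_) (≡.trans (fits-cover used [ v ] c) (≡.cong (λ z → distinctᵇ (verts c) ∧ not z)
                (≡.trans (≡.cong (any used (verts c) ∨_) (≡.trans (any-cong (verts c) (λ w → ∨-identityʳ (v == w)))
                                                               (≡.trans (elem-sym v (verts c)) ev)))
                         (∨-identityʳ _))))

    componentSum-split : ∀ v ok used cs → used v ≡ false → SplitsAt v ok used cs
    componentSum-split v ok used []       uv = componentSum-split-[] v ok used uv
    componentSum-split v ok used (c ∷ cs) uv = byMembership (elemᵇ v (verts c)) ≡.refl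
      where
      byMembership : ∀ b → elemᵇ v (verts c) ≡ b → SplitsAt v ok used (c ∷ cs)
      byMembership true  ev = componentSum-split-∋ v ok used c cs ev (componentSum-split v ok used cs uv)
      byMembership false ev = componentSum-split-∌ v ok used c cs ev (componentSum-split v ok used cs uv)
        (componentSum-split v (ok ∧ fits used c) (cover used (verts c)) cs (≡.trans (≡.cong (used v ∨_) ev) (≡.trans (∨-identityʳ (used v)) uv)))

    fitsAll : (Fin N → Bool) → List (Comp G) → Bool
    fitsAll used L = distinctᵇ (vertsOf G L) ∧ not (any used (vertsOf G L))

    signedWeightAll : List (Comp G) → Carrier
    signedWeightAll L = negOnePow F (Ke G L) * prodL F (map (compWeight F G f φ) L)

    familyTerm : Bool → (Fin N → Bool) → List (Comp G) → Carrier
    familyTerm ok used L = if ok ∧ fitsAll used L then signedWeightAll L * outsideProduct (cover used (vertsOf G L)) else 0#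

    negOnePow-Ke-cons : ∀ c L → negOnePow F (Ke G (c ∷ L)) ≈ negOnePow F (evenCount c) * negOnePow F (Ke G L)
    negOnePow-Ke-cons c L with isEven (length (verts c))
    ... | true = trans (-‿cong (sym (*-identityˡ _))) (-‿distribˡ-* _ _)
    ... | false = sym (*-identityˡ _)

    familyTerm-cons : ∀ ok used c L → familyTerm ok used (c ∷ L) ≈ signedWeight c * familyTerm (ok ∧ fits used c) (cover used (verts c)) L
    familyTerm-cons ok used c L = trans (if-flag _ _ flag val) (sym (if-scale _ (signedWeight c) _))
      where
      A = verts c
      B = vertsOf G L
      flag : (ok ∧ fitsAll used (c ∷ L)) ≡ ((ok ∧ fits used c) ∧ fitsAll (cover used A) L)
      flag rewrite distinct-++ A B | any-++ used A B | any-∨ used (λ w → elemᵇ w A) B =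
        lem ok (distinctᵇ A) (distinctᵇ B) (any (λ w → elemᵇ w A) B) (any used A) (any used B)
        where
        lem : ∀ o a b t i j → (o ∧ ((a ∧ (b ∧ not t)) ∧ not (i ∨ j))) ≡ ((o ∧ (a ∧ not i)) ∧ (b ∧ not (j ∨ t)))
        lem o a b t i j rewrite not-∨ i j | not-∨ j t =
          BS.solve 6 (λ o a b t i j → o BS.:* ((a BS.:* (b BS.:* t)) BS.:* (i BS.:* j)) BS.:= (o BS.:* (a BS.:* i)) BS.:* (b BS.:* (j BS.:* t))) ≡.refl o a b (not t) (not i) (not j)
      val : signedWeightAll (c ∷ L) * outsideProduct (cover used (vertsOf G (c ∷ L))) ≈ signedWeight c * (signedWeightAll L * outsideProduct (cover (cover used A) B))
      val = begin
        negOnePow F (Ke G (c ∷ L)) * (compWeight F G f φ c * prodL F (map (compWeight F G f φ) L)) * outsideProduct (cover used (A ++ B))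
          ≈⟨ *-cong (*-congʳ (negOnePow-Ke-cons c L)) (reflexive (≡.cong (∏ ∘ map diag) (filter-cong (allFin N) (λ w → ≡.cong not
                (≡.trans (≡.cong (used w ∨_) (elem-++ w A B)) (BS.solve 3 (λ a b c → a BS.:+ (b BS.:+ c) BS.:= (a BS.:+ b) BS.:+ c) ≡.refl (used w) (elemᵇ w A) (elemᵇ w B))))))) ⟩
        negOnePow F (evenCount c) * negOnePow F (Ke G L) * (compWeight F G f φ c * prodL F (map (compWeight F G f φ) L)) * outsideProduct (cover (cover used A) B)
          ≈⟨ solve 5 (λ a b w p o → a :* b :* (w :* p) :* o := a :* w :* (b :* p :* o)) refl _ _ _ _ _ ⟩
        signedWeight c * (signedWeightAll L * outsideProduct (cover (cover used A) B)) ∎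

    componentSum≈∑sublists : ∀ ok used cs → componentSum ok used cs ≈ ∑ (map (familyTerm ok used) (sublists cs))
    componentSum≈∑sublists ok used [] = sym (trans (+-identityʳ _) (if-flag _ _ (∧-identityʳ ok)
        (trans (*-congʳ (*-identityˡ _)) (trans (*-identityˡ _) (reflexive (≡.cong (∏ ∘ map diag) (filter-cong (allFin N) (λ w → ≡.cong not (∨-identityʳ (used w))))))))))
    componentSum≈∑sublists ok used (c ∷ cs) = begin
      componentSum ok used cs + signedWeight c * componentSum (ok ∧ fits used c) (cover used (verts c)) cs
        ≈⟨ +-cong (componentSum≈∑sublists ok used cs) (*-congˡ (componentSum≈∑sublists _ _ cs)) ⟩
      ∑ (map (familyTerm ok used) (sublists cs)) + signedWeight c * ∑ (map (familyTerm (ok ∧ fits used c) (cover used (verts c))) (sublists cs))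
        ≈⟨ +-congˡ (trans (sym (sum-scale _ _ (sublists cs))) (sum-cong (sublists cs) (λ L → sym (familyTerm-cons ok used c L)))) ⟩
      ∑ (map (familyTerm ok used) (sublists cs)) + ∑ (map (λ L → familyTerm ok used (c ∷ L)) (sublists cs))
        ≡⟨ ≡.cong (λ z → ∑ (map (familyTerm ok used) (sublists cs)) + ∑ z) (LP.map-∘ (sublists cs)) ⟩
      ∑ (map (familyTerm ok used) (sublists cs)) + ∑ (map (familyTerm ok used) (map (c ∷_) (sublists cs)))
        ≈⟨ sym (sum-++ (map (familyTerm ok used) (sublists cs)) _) ⟩
      ∑ (map (familyTerm ok used) (sublists cs) ++ map (familyTerm ok used) (map (c ∷_) (sublists cs)))
        ≡⟨ ≡.cong ∑ (≡.sym (LP.map-++ (familyTerm ok used) (sublists cs) _)) ⟩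
      ∑ (map (familyTerm ok used) (sublists (c ∷ cs))) ∎

    noneUsed : Fin N → Bool
    noneUsed _ = false

    ∑sublists≈∑elementary : ∀ cs → ∑ (map (familyTerm true noneUsed) (sublists cs)) ≈ familyTerm true noneUsed [] + ∑ (map (term F G f φ x) (filterᵇ (isElementaryᵇ G) (sublists cs)))
    ∑sublists≈∑elementary [] = refl
    ∑sublists≈∑elementary (c ∷ cs) = begin
      ∑ (map (familyTerm true noneUsed) (sublists cs ++ map (c ∷_) (sublists cs)))
        ≡⟨ ≡.cong ∑ (LP.map-++ (familyTerm true noneUsed) (sublists cs) _) ⟩
      ∑ (map (familyTerm true noneUsed) (sublists cs) ++ map (familyTerm true noneUsed) (map (c ∷_) (sublists cs)))
        ≈⟨ sum-++ (map (familyTerm true noneUsed) (sublists cs)) _ ⟩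
      ∑ (map (familyTerm true noneUsed) (sublists cs)) + ∑ (map (familyTerm true noneUsed) (map (c ∷_) (sublists cs)))
        ≈⟨ +-cong (∑sublists≈∑elementary cs) (reflexive (≡.cong ∑ (≡.sym (LP.map-∘ (sublists cs))))) ⟩
      (familyTerm true noneUsed [] + ∑ (map tm (filterᵇ isE (sublists cs)))) + ∑ (map (λ L → familyTerm true noneUsed (c ∷ L)) (sublists cs))
        ≈⟨ +-congˡ (sum-cong (sublists cs) (λ L → if-flag _ _ (fitsAll-noneUsed L) refl)) ⟩
      (familyTerm true noneUsed [] + ∑ (map tm (filterᵇ isE (sublists cs)))) + ∑ (map (λ L → if isE (c ∷ L) then tm (c ∷ L) else 0#) (sublists cs))
        ≡⟨ ≡.cong (λ z → (familyTerm true noneUsed [] + ∑ (map tm (filterᵇ isE (sublists cs)))) + ∑ z) (LP.map-∘ (sublists cs)) ⟩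
      (familyTerm true noneUsed [] + ∑ (map tm (filterᵇ isE (sublists cs)))) + ∑ (map (λ L → if isE L then tm L else 0#) (map (c ∷_) (sublists cs)))
        ≈⟨ +-congˡ (sym (sum-filter isE tm (map (c ∷_) (sublists cs)))) ⟩
      (familyTerm true noneUsed [] + ∑ (map tm (filterᵇ isE (sublists cs)))) + ∑ (map tm (filterᵇ isE (map (c ∷_) (sublists cs))))
        ≈⟨ +-assoc _ _ _ ⟩
      familyTerm true noneUsed [] + (∑ (map tm (filterᵇ isE (sublists cs))) + ∑ (map tm (filterᵇ isE (map (c ∷_) (sublists cs)))))
        ≈⟨ +-congˡ (sym (sum-++ (map tm (filterᵇ isE (sublists cs))) _)) ⟩
      familyTerm true noneUsed [] + ∑ (map tm (filterᵇ isE (sublists cs)) ++ map tm (filterᵇ isE (map (c ∷_) (sublists cs))))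
        ≡⟨ ≡.cong (λ z → familyTerm true noneUsed [] + ∑ z) (≡.sym (LP.map-++ tm (filterᵇ isE (sublists cs)) _)) ⟩
      familyTerm true noneUsed [] + ∑ (map tm (filterᵇ isE (sublists cs) ++ filterᵇ isE (map (c ∷_) (sublists cs))))
        ≡⟨ ≡.cong (λ z → familyTerm true noneUsed [] + ∑ (map tm z)) (≡.sym (LP.filter-++ (T? ∘ isE) (sublists cs) _)) ⟩
      familyTerm true noneUsed [] + ∑ (map tm (filterᵇ isE (sublists cs ++ map (c ∷_) (sublists cs)))) ∎
      where
      tm = term F G f φ x
      isE = isElementaryᵇ G
      fitsAll-noneUsed : ∀ L → (true ∧ fitsAll noneUsed (c ∷ L)) ≡ isE (c ∷ L)
      fitsAll-noneUsed L = ≡.trans (≡.cong (λ z → distinctᵇ (vertsOf G (c ∷ L)) ∧ not z) (any-false (vertsOf G (c ∷ L)))) (∧-identityʳ _)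

    rhs≈componentSum : rhs F G f φ x ≈ componentSum true noneUsed (allComps G)
    rhs≈componentSum = sym (begin
      componentSum true noneUsed (allComps G) ≈⟨ componentSum≈∑sublists true noneUsed (allComps G) ⟩
      ∑ (map (familyTerm true noneUsed) (sublists (allComps G))) ≈⟨ ∑sublists≈∑elementary (allComps G) ⟩
      familyTerm true noneUsed [] + ∑ (map (term F G f φ x) (elementarySubgraphs G)) ≈⟨ +-congʳ familyTerm-[] ⟩
      rhs F G f φ x ∎)
      where
      familyTerm-[] : familyTerm true noneUsed [] ≈ ∏ (map diag (allFin N))
      familyTerm-[] = trans (*-congʳ (*-identityˡ _)) (trans (*-identityˡ _) (reflexive (≡.cong (∏ ∘ map diag) (filter-all-true (allFin N)))))


module ListReversal where

  open import Algebra.Bundles using (CommutativeRing)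
  open import Data.Bool using (Bool; true; false; not; _∧_; _∨_)
  open import Data.Nat using (ℕ; zero; suc)
  open import Data.Fin using (Fin; zero; suc)
  open import Data.List using (List; []; _∷_; _++_; [_]; map; allFin; length; reverse)
  open import Data.Bool.ListAction using (all; any)
  import Data.List.Properties as LP
  open import Data.List.Membership.Propositional using (_∈_)
  open import Data.List.Relation.Unary.All as All using (All; []; _∷_)
  import Data.List.Relation.Unary.All.Properties as AP
  open import Relation.Binary.PropositionalEquality as ≡ using (_≡_)
  open import Defs
  open Summation
  open FinBool
  open ListBool
  open import Data.Bool.Solver
  open ∨-∧-Solver using () renaming (solve to bsolve; _:=_ to _:=b_; _:*_ to _:*b_; _:+_ to _:+b_)

  module _ {a} {A : Set a} where
    all-++ : ∀ (p : A → Bool) X Y → all p (X ++ Y) ≡ (all p X ∧ all p Y)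
    all-++ p [] Y = ≡.refl
    all-++ p (x ∷ X) Y rewrite all-++ p X Y = bsolve 3 (λ a b c → a :*b (b :*b c) :=b (a :*b b) :*b c) ≡.refl (p x) (all p X) (all p Y)

    all-rev : ∀ (p : A → Bool) X → all p (reverse X) ≡ all p X
    all-rev p [] = ≡.refl
    all-rev p (x ∷ X) rewrite LP.unfold-reverse x X | all-++ p (reverse X) [ x ] | all-rev p X =
      bsolve 2 (λ a b → b :*b (a :*b con true) :=b a :*b b) ≡.refl (p x) (all p X)
      where open ∨-∧-Solver using (con)

    any-rev : ∀ (p : A → Bool) X → any p (reverse X) ≡ any p X
    any-rev p [] = ≡.refl
    any-rev p (x ∷ X) rewrite LP.unfold-reverse x X | any-++ p (reverse X) [ x ] | any-rev p X =
      bsolve 2 (λ a b → b :+b (a :+b con false) :=b a :+b b) ≡.refl (p x) (any p X)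
      where open ∨-∧-Solver using (con)

  module _ {n : ℕ} where
    elem-rev : ∀ (w : Fin n) X → elemᵇ w (reverse X) ≡ elemᵇ w X
    elem-rev w X = any-rev (λ u → u == w) X

    distinct-rev : ∀ (X : List (Fin n)) → distinctᵇ (reverse X) ≡ distinctᵇ X
    distinct-rev [] = ≡.refl
    distinct-rev (x ∷ X) rewrite LP.unfold-reverse x X | distinct-++ (reverse X) [ x ] | distinct-rev X
      | any-cong {q = λ w → elemᵇ w X} [ x ] (λ w → elem-rev w X) = lem (distinctᵇ X) (elemᵇ x X)
      where lem : ∀ d e → (d ∧ (true ∧ not (e ∨ false))) ≡ (not e ∧ d)
            lem true true = ≡.refl
            lem true false = ≡.refl
            lem false e = ≡.sym (∧-zeroʳ (not e))

    lastOr-snoc : ∀ {G : SimpleGraph n} (d : Fin n) m x → lastOr G d (m ++ [ x ]) ≡ x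
    lastOr-snoc d [] x = ≡.refl
    lastOr-snoc {G} d (y ∷ m) x = lastOr-snoc {G} y m x

    listsOfLength-length-all : ∀ k → All (λ s → length s ≡ k) (listsOfLength n k)
    listsOfLength-length-all zero = ≡.refl ∷ []
    listsOfLength-length-all (suc k) = AP.concat⁺ (AP.map⁺ (go (allFin n)))
      where
      go : ∀ us → All (λ v → All (λ s → length s ≡ suc k) (map (v ∷_) (listsOfLength n k))) us
      go [] = []
      go (u ∷ us) = AP.map⁺ (All.map (≡.cong suc) (listsOfLength-length-all k)) ∷ go us

    listsOfLength-length : ∀ k (s : List (Fin n)) → s ∈ listsOfLength n k → length s ≡ k
    listsOfLength-length k s m = All.lookup (listsOfLength-length-all k) m

  module SumsOverLists {c ℓ} (F : CommutativeRing c ℓ) {n : ℕ} where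
    open CommutativeRing F hiding (zero)
    open import Relation.Binary.Reasoning.Setoid setoid
    open Sums F

    sum-listsOfLength-cons : ∀ k (F' : List (Fin n) → Carrier) →
      ∑ (map F' (listsOfLength n (suc k))) ≈ ∑ (map (λ t → ∑ (map (λ s → F' (t ∷ s)) (listsOfLength n k))) (allFin n))
    sum-listsOfLength-cons k F' = trans (sum-concatMap F' _ (allFin n)) (sum-cong (allFin n) (λ t → reflexive (≡.cong ∑ (≡.sym (LP.map-∘ (listsOfLength n k))))))

    sum-listsOfLength-snoc : ∀ k (F' : List (Fin n) → Carrier) →
      ∑ (map F' (listsOfLength n (suc k))) ≈ ∑ (map (λ s → ∑ (map (λ t → F' (s ++ [ t ])) (allFin n))) (listsOfLength n k))
    sum-listsOfLength-snoc zero F' = trans (sum-listsOfLength-cons zero F') (trans (sum-cong (allFin n) (λ t → +-identityʳ _)) (sym (+-identityʳ _)))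
    sum-listsOfLength-snoc (suc k) F' = begin
      ∑ (map F' (listsOfLength n (suc (suc k))))
        ≈⟨ sum-listsOfLength-cons (suc k) F' ⟩
      ∑ (map (λ u → ∑ (map (λ s → F' (u ∷ s)) (listsOfLength n (suc k)))) (allFin n))
        ≈⟨ sum-cong (allFin n) (λ u → sum-listsOfLength-snoc k (λ s → F' (u ∷ s))) ⟩
      ∑ (map (λ u → ∑ (map (λ s → ∑ (map (λ t → F' (u ∷ s ++ [ t ])) (allFin n))) (listsOfLength n k))) (allFin n))
        ≈⟨ sym (sum-listsOfLength-cons k _) ⟩
      ∑ (map (λ s → ∑ (map (λ t → F' (s ++ [ t ])) (allFin n))) (listsOfLength n (suc k))) ∎

    sum-listsOfLength-reverse : ∀ k (F' : List (Fin n) → Carrier) →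
      ∑ (map F' (listsOfLength n k)) ≈ ∑ (map (λ s → F' (reverse s)) (listsOfLength n k))
    sum-listsOfLength-reverse zero F' = refl
    sum-listsOfLength-reverse (suc k) F' = begin
      ∑ (map F' (listsOfLength n (suc k)))
        ≈⟨ sum-listsOfLength-cons k F' ⟩
      ∑ (map (λ u → ∑ (map (λ s → F' (u ∷ s)) (listsOfLength n k))) (allFin n))
        ≈⟨ sum-cong (allFin n) (λ u → sum-listsOfLength-reverse k (λ s → F' (u ∷ s))) ⟩
      ∑ (map (λ u → ∑ (map (λ s → F' (u ∷ reverse s)) (listsOfLength n k))) (allFin n))
        ≈⟨ sum-swap (λ u s → F' (u ∷ reverse s)) (allFin n) (listsOfLength n k) ⟩
      ∑ (map (λ s → ∑ (map (λ u → F' (u ∷ reverse s)) (allFin n))) (listsOfLength n k))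
        ≈⟨ sum-cong (listsOfLength n k) (λ s → sum-cong (allFin n) (λ u → reflexive (≡.cong F' (≡.sym (LP.reverse-++ s [ u ]))))) ⟩
      ∑ (map (λ s → ∑ (map (λ u → F' (reverse (s ++ [ u ]))) (allFin n))) (listsOfLength n k))
        ≈⟨ sym (sum-listsOfLength-snoc k (λ s → F' (reverse s))) ⟩
      ∑ (map (λ s → F' (reverse s)) (listsOfLength n (suc k))) ∎


module GainReversal where

  open import Algebra.Bundles using (CommutativeRing)
  open import Data.Bool using (true; false; _∧_; T)
  open import Data.Nat using (ℕ; zero; suc)
  open import Data.Fin using (Fin; zero; suc)
  open import Data.List using (List; []; _∷_; _++_; [_]; reverse)
  import Data.List.Properties as LP
  open import Relation.Binary.PropositionalEquality as ≡ using (_≡_)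
  open import Relation.Nullary using (¬_)
  open import Data.Product using (_×_; proj₁; proj₂)
  open import Data.Unit using (tt)
  open import Defs
  open Summation
  open FinBool
  open ListBool
  open ListReversal

  reverse-cons₂ : ∀ {a} {A : Set a} (x y : A) r → reverse (x ∷ y ∷ r) ≡ reverse r ++ y ∷ x ∷ []
  reverse-cons₂ x y r = ≡.trans (LP.unfold-reverse x (y ∷ r)) (≡.trans (≡.cong (_++ [ x ]) (LP.unfold-reverse y r)) (LP.++-assoc (reverse r) [ y ] [ x ]))

  ≡true⇒T : ∀ {b} → b ≡ true → T b
  ≡true⇒T ≡.refl = tt

  module ForSkewGain {c ℓ} (F : CommutativeRing c ℓ) (fld : IsFieldCharZero F)
            (f : CommutativeRing.Carrier F → CommutativeRing.Carrier F) (inv : IsInvolutiveAutUnits F f)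
            {N : ℕ} (G : SimpleGraph N) (φ : Fin N → Fin N → CommutativeRing.Carrier F) (sk : IsSkewGain F G f φ) where
    open CommutativeRing F hiding (zero)
    open import Relation.Binary.Reasoning.Setoid setoid
    open Sums F
    open IsFieldCharZero fld
    open IsInvolutiveAutUnits inv renaming (cong to fcong)
    open IsSkewGain sk
    open SimpleGraph G

    *-nonzero : ∀ {a b} → ¬ (a ≈ 0#) → ¬ (b ≈ 0#) → ¬ (a * b ≈ 0#)
    *-nonzero {a} {b} na nb ab = nb (begin
      b ≈⟨ sym (*-identityˡ b) ⟩
      1# * b ≈⟨ *-congʳ (sym (trans (*-comm _ _) (proj₂ ia))) ⟩
      (proj₁ ia * a) * b ≈⟨ *-assoc _ _ _ ⟩
      proj₁ ia * (a * b) ≈⟨ *-congˡ ab ⟩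
      proj₁ ia * 0# ≈⟨ zeroʳ _ ⟩
      0# ∎)
      where ia = inverse a na

    f-1# : f 1# ≈ 1#
    f-1# = sym (begin
      1# ≈⟨ sym (proj₂ iv) ⟩
      f 1# * y ≈⟨ *-congʳ f-1#-idem ⟩
      (f 1# * f 1#) * y ≈⟨ *-assoc _ _ _ ⟩
      f 1# * (f 1# * y) ≈⟨ *-congˡ (proj₂ iv) ⟩
      f 1# * 1# ≈⟨ *-identityʳ _ ⟩
      f 1# ∎)
      where
      iv = inverse (f 1#) (unit 1# 1≉0)
      y = proj₁ iv
      f-1#-idem : f 1# ≈ f 1# * f 1#
      f-1#-idem = trans (fcong 1# (1# * 1#) 1≉0 (sym (*-identityˡ 1#))) (hom 1# 1# 1≉0 1≉0)

    gain : List (Fin N) → Carrier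
    gain = pathGain F G f φ

    pathᵇ-cons : ∀ a b r → pathᵇ G (a ∷ b ∷ r) ≡ true → (adj a b ≡ true) × (pathᵇ G (b ∷ r) ≡ true)
    pathᵇ-cons a b r e = ∧-true e

    pathGain-nonzero : ∀ l → pathᵇ G l ≡ true → ¬ (gain l ≈ 0#)
    pathGain-nonzero [] e = 1≉0
    pathGain-nonzero (a ∷ []) e = 1≉0
    pathGain-nonzero (a ∷ b ∷ r) e = *-nonzero (nonzero a b (≡true⇒T (proj₁ (pathᵇ-cons a b r e)))) (pathGain-nonzero (b ∷ r) (proj₂ (pathᵇ-cons a b r e)))

    pathGain-snoc : ∀ m y x → gain (m ++ y ∷ x ∷ []) ≈ gain (m ++ [ y ]) * φ y x
    pathGain-snoc [] y x = trans (*-identityʳ _) (sym (*-identityˡ _))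
    pathGain-snoc (c ∷ []) y x = trans (*-congˡ (*-identityʳ _)) (sym (*-congʳ (*-identityʳ _)))
    pathGain-snoc (c ∷ d ∷ m) y x = trans (*-congˡ (pathGain-snoc (d ∷ m) y x)) (sym (*-assoc _ _ _))

    pathᵇ-snoc₂ : ∀ m y x → pathᵇ G (m ++ y ∷ x ∷ []) ≡ (pathᵇ G (m ++ [ y ]) ∧ adj y x)
    pathᵇ-snoc₂ [] y x = ∧-identityʳ (adj y x)
    pathᵇ-snoc₂ (c ∷ []) y x = ≡.trans (≡.cong (adj c y ∧_) (∧-identityʳ (adj y x))) (≡.cong (_∧ adj y x) (≡.sym (∧-identityʳ (adj c y))))
    pathᵇ-snoc₂ (c ∷ d ∷ m) y x = ≡.trans (≡.cong (adj c d ∧_) (pathᵇ-snoc₂ (d ∷ m) y x)) (≡.sym (∧-assoc (adj c d) _ _))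

    pathᵇ-reverse : ∀ l → pathᵇ G (reverse l) ≡ pathᵇ G l
    pathᵇ-reverse [] = ≡.refl
    pathᵇ-reverse (a ∷ []) = ≡.refl
    pathᵇ-reverse (a ∷ b ∷ r) =
      ≡.trans (≡.cong (pathᵇ G) (reverse-cons₂ a b r)) (≡.trans (pathᵇ-snoc₂ (reverse r) b a)
       (≡.trans (≡.cong₂ _∧_ (≡.trans (≡.cong (pathᵇ G) (≡.sym (LP.unfold-reverse b r))) (pathᵇ-reverse (b ∷ r))) (symm b a)) (∧-comm (pathᵇ G (b ∷ r)) (adj a b))))

    pathGain-reverse : ∀ l → pathᵇ G l ≡ true → gain (reverse l) ≈ f (gain l)
    pathGain-reverse [] e = sym f-1#
    pathGain-reverse (a ∷ []) e = sym f-1#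
    pathGain-reverse (a ∷ b ∷ r) e = begin
      gain (reverse (a ∷ b ∷ r)) ≡⟨ ≡.cong gain (reverse-cons₂ a b r) ⟩
      gain (reverse r ++ b ∷ a ∷ []) ≈⟨ pathGain-snoc (reverse r) b a ⟩
      gain (reverse r ++ [ b ]) * φ b a ≡⟨ ≡.cong (λ z → gain z * φ b a) (≡.sym (LP.unfold-reverse b r)) ⟩
      gain (reverse (b ∷ r)) * φ b a ≈⟨ *-cong (pathGain-reverse (b ∷ r) pr) (skew a b (≡true⇒T ab)) ⟩
      f (gain (b ∷ r)) * f (φ a b) ≈⟨ sym (hom _ _ (pathGain-nonzero (b ∷ r) pr) (nonzero a b (≡true⇒T ab))) ⟩
      f (gain (b ∷ r) * φ a b) ≈⟨ fcong _ _ (*-nonzero (pathGain-nonzero (b ∷ r) pr) (nonzero a b (≡true⇒T ab))) (*-comm _ _) ⟩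
      f (φ a b * gain (b ∷ r)) ∎
      where
      ab : adj a b ≡ true
      ab = proj₁ (pathᵇ-cons a b r e)
      pr : pathᵇ G (b ∷ r) ≡ true
      pr = proj₂ (pathᵇ-cons a b r e)


module VertexExpansion where

  open import Algebra.Bundles using (CommutativeRing)
  open import Data.Bool using (Bool; true; false; if_then_else_; not; _∧_; _∨_)
  open import Data.Nat using (ℕ; zero; suc; _<_; _≤_; _<ᵇ_; _≤ᵇ_)
  import Data.Nat.Properties as NP
  open import Data.Fin using (Fin; zero; suc; toℕ)
  import Data.Fin.Properties as FP
  open import Data.List using (List; []; _∷_; _++_; [_]; map; allFin; filterᵇ; length; reverse; concatMap; upTo)
  open import Data.Bool.ListAction using (all; any)
  import Data.List.Properties as LP
  open import Data.List.Membership.Propositional using (_∈_)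
  open import Data.List.Relation.Unary.Unique.Propositional.Properties using (allFin⁺)
  open import Data.List.Relation.Unary.Unique.Propositional using (Unique)
  open import Data.List.Relation.Unary.AllPairs using ([]; _∷_)
  open import Data.List.Membership.Propositional.Properties using (∈-allFin)
  open import Relation.Binary.PropositionalEquality as ≡ using (_≡_; _≢_)
  open import Data.Empty using (⊥)
  open import Data.Product using (_×_; proj₁; proj₂)
  open import Defs
  open Summation
  open FinBool
  open ListBool
  open ListReversal
  open GainReversal
  open ListDeterminant
  open MinorExpansion
  open ComponentSums

  hdOr : ∀ {a} {A : Set a} → A → List A → A
  hdOr d [] = d
  hdOr d (x ∷ _) = x

  module _ {n : ℕ} {G : SimpleGraph n} where
    hdOr-++ : ∀ (d : Fin n) X Y → hdOr d (X ++ Y) ≡ hdOr (hdOr d Y) X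
    hdOr-++ d [] Y = ≡.refl
    hdOr-++ d (x ∷ X) Y = ≡.refl

    hd-rev : ∀ (d a : Fin n) r → hdOr d (reverse (a ∷ r)) ≡ lastOr G a r
    hd-rev d a [] = ≡.refl
    hd-rev d a (b ∷ r) = ≡.trans (≡.cong (hdOr d) (LP.unfold-reverse a (b ∷ r))) (≡.trans (hdOr-++ d (reverse (b ∷ r)) [ a ]) (hd-rev a b r))

    last-rev : ∀ (d a : Fin n) r → lastOr G d (reverse (a ∷ r)) ≡ a
    last-rev d a r = ≡.trans (≡.cong (lastOr G d) (LP.unfold-reverse a r)) (lastOr-snoc {G = G} d (reverse r) a)

    lastOr-elem : ∀ (a b : Fin n) r → elemᵇ (lastOr G a (b ∷ r)) (b ∷ r) ≡ true
    lastOr-elem a b [] rewrite ==-refl b = ≡.refl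
    lastOr-elem a b (c ∷ r) rewrite lastOr-elem b c r = ∨-zeroʳ (b == lastOr G c r)

    pathᵇ-snoc : ∀ (u : Fin n) m x → pathᵇ G (u ∷ m ++ [ x ]) ≡ (pathᵇ G (u ∷ m) ∧ SimpleGraph.adj G (lastOr G u m) x)
    pathᵇ-snoc u [] x = ∧-identityʳ _
    pathᵇ-snoc u (y ∷ m) x = ≡.trans (≡.cong (SimpleGraph.adj G u y ∧_) (pathᵇ-snoc y m x)) (lem (SimpleGraph.adj G u y) _ _)
      where lem : ∀ a b c → (a ∧ (b ∧ c)) ≡ ((a ∧ b) ∧ c)
            lem true b c = ≡.refl
            lem false b c = ≡.refl

    adjacentDistinctᵇ : List (Fin n) → Bool
    adjacentDistinctᵇ (a ∷ b ∷ r) = not (a == b) ∧ adjacentDistinctᵇ (b ∷ r)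
    adjacentDistinctᵇ _ = true

    distinct-head : ∀ (u t : Fin n) s → distinctᵇ (u ∷ t ∷ s) ≡ true → (u == t) ≡ false
    distinct-head u t s d = ≡.trans (==-sym u t) (proj₁ (∨-false (not-true (proj₁ (∧-true d)))))

    adjacentDistinct-closedWalk : ∀ (u : Fin n) t s w → distinctᵇ (u ∷ t ∷ s) ≡ true → elemᵇ w (t ∷ s) ≡ false → adjacentDistinctᵇ (u ∷ t ∷ s ++ [ w ]) ≡ true
    adjacentDistinct-closedWalk u t [] w d e rewrite distinct-head u t [] d = ≡.cong (λ b → not b ∧ true) (proj₁ (∨-false e))
    adjacentDistinct-closedWalk u t (t' ∷ s) w d e rewrite distinct-head u t (t' ∷ s) d = adjacentDistinct-closedWalk t t' s w (proj₂ (∧-true {not (elemᵇ u (t ∷ t' ∷ s))} d)) (proj₂ (∨-false {t == w} e))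

  module AtPoint {c ℓ} (F : CommutativeRing c ℓ) (fld : IsFieldCharZero F)
            (f : CommutativeRing.Carrier F → CommutativeRing.Carrier F) (inv : IsInvolutiveAutUnits F f)
            {N : ℕ} (G : SimpleGraph N) (φ : Fin N → Fin N → CommutativeRing.Carrier F) (sk : IsSkewGain F G f φ)
            (x : CommutativeRing.Carrier F) where
    open CommutativeRing F hiding (zero)
    open import Relation.Binary.Reasoning.Setoid setoid
    open Sums F

    M : Fin N → Fin N → Carrier
    M i j = δ F i j * x - laplacian F G f φ i j

    open ForMatrix F M public
    open ForGraph F G f φ x public
    open ForSkewGain F fld f inv G φ sk public
    open SimpleGraph G
    open IsSkewGain sk
    open IsInvolutiveAutUnits inv renaming (cong to fcong)
    import Data.Integer as ℤ

    M-offDiagonal : ∀ i j → (i == j) ≡ false → M i j ≈ (if adj i j then φ i j else 0#)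
    M-offDiagonal i j e = begin
      δ F i j * x - (δ F i j * d F G f φ i - adjMat F G f φ i j) ≡⟨ ≡.cong (λ z → z * x - (z * d F G f φ i - adjMat F G f φ i j)) (≡.cong (λ b → if b then 1# else 0#) e) ⟩
      0# * x - (0# * d F G f φ i - adjMat F G f φ i j) ≈⟨ solve 3 (λ a b c → con (ℤ.+ 0) :* a :- (con (ℤ.+ 0) :* b :- c) := c) refl x _ _ ⟩
      adjMat F G f φ i j ∎

    M-diagonal : ∀ v → M v v ≈ diag v
    M-diagonal v = begin
      δ F v v * x - (δ F v v * d F G f φ v - adjMat F G f φ v v)
        ≡⟨ ≡.cong₂ (λ z w → z * x - (z * d F G f φ v - w)) (≡.cong (λ b → if b then 1# else 0#) (==-refl v)) (≡.cong (λ b → if b then φ v v else 0#) (irrefl v)) ⟩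
      1# * x - (1# * d F G f φ v - 0#) ≈⟨ +-cong (*-identityˡ x) (-‿cong (trans (+-congʳ (*-identityˡ _)) (trans (+-congˡ (-0#≈0#)) (+-identityʳ _)))) ⟩
      diag v ∎

    walkProduct≈pathGain : ∀ u s w → adjacentDistinctᵇ {G = G} (u ∷ s ++ [ w ]) ≡ true → walkProduct u s w ≈ (if pathᵇ G (u ∷ s ++ [ w ]) then gain (u ∷ s ++ [ w ]) else 0#)
    walkProduct≈pathGain u [] w cd = trans (M-offDiagonal u w (not-true (proj₁ (∧-true {not (u == w)} cd)))) (lem (adj u w))
      where lem : ∀ b → (if b then φ u w else 0#) ≈ (if b ∧ true then φ u w * 1# else 0#)
            lem true = sym (*-identityʳ _)
            lem false = refl
    walkProduct≈pathGain u (t ∷ s) w cd = trans (*-cong (M-offDiagonal u t (not-true (proj₁ (∧-true {not (u == t)} cd)))) (walkProduct≈pathGain t s w (proj₂ (∧-true {not (u == t)} cd))))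
                                  (if-mul (adj u t) (pathᵇ G (t ∷ s ++ [ w ])) (φ u t) (gain (t ∷ s ++ [ w ])))

    all-mono : ∀ {p q : Fin N → Bool} s → (∀ w → p w ≡ true → q w ≡ true) → all p s ≡ true → all q s ≡ true
    all-mono [] h e = ≡.refl
    all-mono {p} {q} (a ∷ s) h e = ≡.cong₂ _∧_ (h a (proj₁ (∧-true {p a} e))) (all-mono s h (proj₂ (∧-true {p a} e)))

    all-not : ∀ (used : Fin N → Bool) s → all (λ w → not (used w)) s ≡ not (any used s)
    all-not used [] = ≡.refl
    all-not used (a ∷ s) rewrite all-not used s = ≡.sym (not-∨ (used a) (any used s))

    module LeastVertex (v : Fin N) (used : Fin N → Bool) (uv : used v ≡ false) (below : ∀ w → toℕ w < toℕ v → used w ≡ true) where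
      others : Fin N → Bool
      others = without (λ w → not (used w)) v

      minorAvoiding : List (Fin N) → Carrier
      minorAvoiding s = principalMinor (vertices (avoiding others s))

      minorOutside : List (Fin N) → Carrier
      minorOutside X = principalMinor (vertices (λ w → not (cover used X w)))

      throughTerm : Comp G → Carrier
      throughTerm c = if elemᵇ v (verts c) then signedWeight c * (if fits used c then minorOutside (verts c) else 0#) else 0#

      simple-others : ∀ s → (distinctᵇ s ∧ all others s) ≡ (distinctᵇ (v ∷ s) ∧ not (any used s))
      simple-others s rewrite all-∧-not (λ w → not (used w)) v s | all-not used s =
        BS.solve 3 (λ d a e → d BS.:* (a BS.:* e) BS.:= (e BS.:* d) BS.:* a) ≡.refl (distinctᵇ s) (not (any used s)) (not (elemᵇ v s))

      minorOutside-cons : ∀ s → minorOutside (v ∷ s) ≡ minorAvoiding s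
      minorOutside-cons s = ≡.cong principalMinor (filter-cong (allFin N) (λ w → ≡.trans (≡.cong (λ z → not (used w ∨ (z ∨ elemᵇ w s))) (==-sym v w)) (lem (used w) (w == v) (elemᵇ w s))))
        where lem : ∀ a b c → not (a ∨ (b ∨ c)) ≡ ((not a ∧ not b) ∧ not c)
              lem true b c = ≡.refl
              lem false true c = ≡.refl
              lem false false c = ≡.refl

      least-≤ : ∀ w → not (used w) ≡ true → (toℕ v ≤ᵇ toℕ w) ≡ true
      least-≤ w e = T⇒≡true (NP.≤⇒≤ᵇ (NP.≮⇒≥ (λ w<v → case (≡.trans (≡.sym (not-true e)) (below w w<v)))))
        where case : false ≡ true → ⊥
              case ()

      least-< : ∀ w → used w ≡ false → (w == v) ≡ false → toℕ v < toℕ w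
      least-< w e wv = NP.≤∧≢⇒< (NP.≮⇒≥ (λ w<v → case (≡.trans (≡.sym e) (below w w<v))))
                        (λ eq → ==-false⇒≢ w v wv (≡.sym (FP.toℕ-injective eq)))
        where case : false ≡ true → ⊥
              case ()

      walkSum₀ : walkSum v v others 0 ≈ diag v * principalMinor (vertices others)
      walkSum₀ = trans (+-identityʳ _) (trans (*-congʳ (trans (*-identityˡ _) (M-diagonal v)))
            (*-congˡ (reflexive (≡.cong principalMinor (filter-cong (allFin N) (λ w → ∧-identityʳ (others w)))))))

      throughTerm-unfit : ∀ c → fits used c ≡ false → throughTerm c ≈ 0#
      throughTerm-unfit c e = if-zero (elemᵇ v (verts c)) (λ _ → trans (*-congˡ (reflexive (if-false _ e))) (zeroʳ _))

      sum-singleton : ∀ (b : Bool) cc → ∑ (map throughTerm (if b then cc ∷ [] else [])) ≈ (if b then throughTerm cc else 0#)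
      sum-singleton true cc = +-identityʳ _
      sum-singleton false cc = refl

      edgeTerm-elsewhere : ∀ i j → (i == v) ≡ false → (if (toℕ i <ᵇ toℕ j) ∧ adj i j then throughTerm (k2 i j) else 0#) ≈ 0#
      edgeTerm-elsewhere i j iv' = cases ((toℕ i <ᵇ toℕ j) ∧ adj i j) ≡.refl
        where
        cases : ∀ b → ((toℕ i <ᵇ toℕ j) ∧ adj i j) ≡ b → (if b then throughTerm (k2 i j) else 0#) ≈ 0#
        cases false _ = refl
        cases true eb = cases2 (j == v) ≡.refl
          where
          ij : toℕ i < toℕ j
          ij = NP.<ᵇ⇒< (toℕ i) (toℕ j) (≡true⇒T (proj₁ (∧-true eb)))
          cases2 : ∀ b → (j == v) ≡ b → throughTerm (k2 i j) ≈ 0#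
          cases2 true jv = throughTerm-unfit (k2 i j) (≡.trans (≡.cong (λ z → distinctᵇ (verts (k2 i j)) ∧ not (z ∨ (used j ∨ false)))
                                (below i (≡.subst (λ z → toℕ i < toℕ z) (==-true j v jv) ij)))
                                (∧-zeroʳ (distinctᵇ (verts (k2 i j)))))
          cases2 false jv = reflexive (if-false _ (≡.cong₂ (λ a b → a ∨ (b ∨ false)) iv' jv))

      edgeTerm : Fin N → Carrier
      edgeTerm t = if (toℕ v <ᵇ toℕ t) ∧ adj v t then throughTerm (k2 v t) else 0#

      ∑edges≈edgesAt : ∑ (map throughTerm (allK2 G)) ≈ ∑ (map edgeTerm (allFin N))
      ∑edges≈edgesAt = begin
        ∑ (map throughTerm (allK2 G)) ≈⟨ sum-concatMap throughTerm _ (allFin N) ⟩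
        ∑ (map (λ i → ∑ (map throughTerm (concatMap (λ j → if (toℕ i <ᵇ toℕ j) ∧ adj i j then k2 i j ∷ [] else []) (allFin N)))) (allFin N))
          ≈⟨ sum-cong (allFin N) (λ i → trans (sum-concatMap throughTerm _ (allFin N)) (sum-cong (allFin N) (λ j → sum-singleton ((toℕ i <ᵇ toℕ j) ∧ adj i j) (k2 i j)))) ⟩
        ∑ (map (λ i → ∑ (map (λ j → if (toℕ i <ᵇ toℕ j) ∧ adj i j then throughTerm (k2 i j) else 0#) (allFin N))) (allFin N))
          ≈⟨ sum-single v _ (allFin N) (allFin⁺ N) (∈-allFin v) (λ i iv' → sum-zero _ (allFin N) (λ j _ → edgeTerm-elsewhere i j iv')) ⟩
        ∑ (map (λ j → if (toℕ v <ᵇ toℕ j) ∧ adj v j then throughTerm (k2 v j) else 0#) (allFin N)) ∎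

      edgeTerm-self : ∀ t → (t == v) ≡ true → edgeTerm t ≈ walkTerm v v others 1 (t ∷ [])
      edgeTerm-self t tv = reflexive (≡.trans
        (if-false _ (≡.cong (_∧ adj v t) (≡.trans (≡.cong (λ z → toℕ v <ᵇ toℕ z) (==-true t v tv)) (<ᵇ-irrefl (toℕ v)))))
        (≡.sym (if-false _ (≡.trans (≡.cong (λ z → (not (used t) ∧ not z) ∧ true) tv) (≡.cong (_∧ true) (∧-zeroʳ (not (used t))))))))

      edgeTerm-used : ∀ t → used t ≡ true → edgeTerm t ≈ walkTerm v v others 1 (t ∷ [])
      edgeTerm-used t ut = trans
        (if-zero ((toℕ v <ᵇ toℕ t) ∧ adj v t) (λ _ → throughTerm-unfit (k2 v t)
          (≡.trans (≡.cong₂ (λ a b → distinctᵇ (v ∷ t ∷ []) ∧ not (a ∨ (b ∨ false))) uv ut) (∧-zeroʳ _))))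
        (reflexive (≡.sym (if-false _ (≡.cong (λ z → (not z ∧ not (t == v)) ∧ true) ut))))

      edgeTerm-free : ∀ t → (t == v) ≡ false → used t ≡ false → edgeTerm t ≈ walkTerm v v others 1 (t ∷ [])
      edgeTerm-free t tv ut = byAdjacency (adj v t) ≡.refl
        where
        v<t : toℕ v < toℕ t
        v<t = least-< t ut tv
        vt : (v == t) ≡ false
        vt = ≡.trans (==-sym v t) tv
        others-t : (others t ∧ true) ≡ true
        others-t = ≡.cong₂ (λ a b → (not a ∧ not b) ∧ true) ut tv
        fits-vt : fits used (k2 v t) ≡ true
        fits-vt rewrite tv | uv | ut = ≡.refl
        byAdjacency : ∀ b → adj v t ≡ b → edgeTerm t ≈ walkTerm v v others 1 (t ∷ [])
        byAdjacency true vt-adj = begin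
          edgeTerm t
            ≡⟨ if-true _ (≡.cong₂ _∧_ (T⇒≡true (NP.<⇒<ᵇ v<t)) vt-adj) ⟩
          throughTerm (k2 v t)
            ≡⟨ if-true _ (≡.cong (_∨ ((t == v) ∨ false)) (==-refl v)) ⟩
          signedWeight (k2 v t) * (if fits used (k2 v t) then minorOutside (v ∷ t ∷ []) else 0#)
            ≡⟨ ≡.cong (signedWeight (k2 v t) *_) (if-true _ fits-vt) ⟩
          (- 1#) * (φ v t * f (φ v t)) * minorOutside (v ∷ t ∷ [])
            ≈⟨ *-cong (*-congˡ (sym (*-cong (trans (M-offDiagonal v t vt) (reflexive (if-true _ vt-adj)))
                                             (trans (M-offDiagonal t v tv) (trans (reflexive (if-true _ (≡.trans (symm t v) vt-adj))) (skew v t (≡true⇒T vt-adj)))))))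
                      (reflexive (minorOutside-cons (t ∷ []))) ⟩
          (- 1#) * (M v t * M t v) * minorAvoiding (t ∷ [])
            ≡⟨ ≡.sym (if-true _ others-t) ⟩
          walkTerm v v others 1 (t ∷ []) ∎
        byAdjacency false vt-adj = trans
          (reflexive (if-false (throughTerm (k2 v t)) (≡.trans (≡.cong ((toℕ v <ᵇ toℕ t) ∧_) vt-adj) (∧-zeroʳ (toℕ v <ᵇ toℕ t)))))
          (sym (trans (reflexive (if-true _ others-t))
            (trans (*-congʳ (*-congˡ (*-congʳ (trans (M-offDiagonal v t vt) (reflexive (if-false _ vt-adj))))))
              (solve 3 (λ a b c → a :* (con (ℤ.+ 0) :* b) :* c := con (ℤ.+ 0)) refl _ _ _))))

      edgeTerm≈walkTerm : ∀ t → edgeTerm t ≈ walkTerm v v others 1 (t ∷ [])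
      edgeTerm≈walkTerm t = byCases (t == v) (used t) ≡.refl ≡.refl
        where
        byCases : ∀ a b → (t == v) ≡ a → used t ≡ b → edgeTerm t ≈ walkTerm v v others 1 (t ∷ [])
        byCases true  _     tv _  = edgeTerm-self t tv
        byCases false true  _  ut = edgeTerm-used t ut
        byCases false false tv ut = edgeTerm-free t tv ut

      edgesAt≈walkSum₁ : ∑ (map edgeTerm (allFin N)) ≈ walkSum v v others 1
      edgesAt≈walkSum₁ = trans (sum-cong (allFin N) (λ t → trans (edgeTerm≈walkTerm t) (sym (+-identityʳ _))))
                               (sym (SumsOverLists.sum-listsOfLength-cons F 0 (walkTerm v v others 1)))

      simpleᵇ : List (Fin N) → Bool
      simpleᵇ s = distinctᵇ s ∧ all others s

      closedWalkᵇ : List (Fin N) → Bool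
      closedWalkᵇ s = pathᵇ G (v ∷ s ++ [ v ])

      orientedᵇ : List (Fin N) → Bool
      orientedᵇ s = toℕ (hdOr v s) <ᵇ toℕ (lastOr G v s)

      closedWalkGain : List (Fin N) → Carrier
      closedWalkGain s = gain (v ∷ s ++ [ v ])

      sign : ℕ → Carrier
      sign k = negOnePow F k

      simple-facts : ∀ s → simpleᵇ s ≡ true → (distinctᵇ (v ∷ s) ≡ true) × (not (any used s) ≡ true)
      simple-facts s e = ∧-true (≡.trans (≡.sym (simple-others s)) e)

      closedWalkTerm : ℕ → List (Fin N) → Carrier
      closedWalkTerm k s = if simpleᵇ s ∧ closedWalkᵇ s then sign k * closedWalkGain s * minorAvoiding s else 0#

      walkTerm≈closedWalkTerm : ∀ k t s → walkTerm v v others k (t ∷ s) ≈ closedWalkTerm k (t ∷ s)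
      walkTerm≈closedWalkTerm k t s = bySimplicity (simpleᵇ (t ∷ s)) ≡.refl
        where
        bySimplicity : ∀ b → simpleᵇ (t ∷ s) ≡ b → walkTerm v v others k (t ∷ s) ≈ closedWalkTerm k (t ∷ s)
        bySimplicity false e = reflexive (≡.trans (if-false _ e) (≡.sym (if-false _ (≡.cong (_∧ closedWalkᵇ (t ∷ s)) e))))
        bySimplicity true e = begin
          walkTerm v v others k (t ∷ s)
            ≡⟨ if-true _ e ⟩
          sign k * walkProduct v (t ∷ s) v * minorAvoiding (t ∷ s)
            ≈⟨ *-congʳ (*-congˡ (walkProduct≈pathGain v (t ∷ s) v adjacent-distinct)) ⟩
          sign k * (if closedWalkᵇ (t ∷ s) then closedWalkGain (t ∷ s) else 0#) * minorAvoiding (t ∷ s)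
            ≈⟨ if-in (closedWalkᵇ (t ∷ s)) _ _ _ ⟩
          (if closedWalkᵇ (t ∷ s) then sign k * closedWalkGain (t ∷ s) * minorAvoiding (t ∷ s) else 0#)
            ≡⟨ ≡.cong (λ z → if z ∧ closedWalkᵇ (t ∷ s) then sign k * closedWalkGain (t ∷ s) * minorAvoiding (t ∷ s) else 0#) (≡.sym e) ⟩
          closedWalkTerm k (t ∷ s) ∎
          where
          distinct : distinctᵇ (v ∷ t ∷ s) ≡ true
          distinct = proj₁ (simple-facts (t ∷ s) e)
          adjacent-distinct : adjacentDistinctᵇ {G = G} (v ∷ (t ∷ s) ++ [ v ]) ≡ true
          adjacent-distinct = adjacentDistinct-closedWalk {G = G} v t s v distinct (not-true (proj₁ (∧-true {not (elemᵇ v (t ∷ s))} distinct)))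

      negOnePow-evenCount : ∀ k → negOnePow F (if isEven (suc k) then 1 else 0) ≈ negOnePow F k
      negOnePow-evenCount zero = refl
      negOnePow-evenCount (suc zero) = refl
      negOnePow-evenCount (suc (suc k)) = trans (negOnePow-evenCount k) (sym (-‿involutive _))

      forwardTerm : ℕ → List (Fin N) → Carrier
      forwardTerm k s = if (simpleᵇ s ∧ closedWalkᵇ s) ∧ orientedᵇ s then sign k * closedWalkGain s * minorAvoiding s else 0#

      backwardTerm : ℕ → List (Fin N) → Carrier
      backwardTerm k s = if (simpleᵇ s ∧ closedWalkᵇ s) ∧ not (orientedᵇ s) then sign k * closedWalkGain s * minorAvoiding s else 0#

      reversedTerm : ℕ → List (Fin N) → Carrier
      reversedTerm k s = if (simpleᵇ s ∧ closedWalkᵇ s) ∧ orientedᵇ s then sign k * f (closedWalkGain s) * minorAvoiding s else 0#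

      cycleTerm : ℕ → List (Fin N) → Carrier
      cycleTerm k s = if (simpleᵇ s ∧ closedWalkᵇ s) ∧ orientedᵇ s then sign k * (closedWalkGain s + f (closedWalkGain s)) * minorAvoiding s else 0#

      simple-reverse : ∀ s → simpleᵇ (reverse s) ≡ simpleᵇ s
      simple-reverse s = ≡.cong₂ _∧_ (distinct-rev s) (all-rev others s)

      closedWalk-reverse-list : ∀ s → v ∷ reverse s ++ [ v ] ≡ reverse (v ∷ s ++ [ v ])
      closedWalk-reverse-list s = ≡.sym (≡.trans (LP.unfold-reverse v (s ++ [ v ])) (≡.cong (_++ [ v ]) (LP.reverse-++ s [ v ])))

      closedWalk-reverse : ∀ s → closedWalkᵇ (reverse s) ≡ closedWalkᵇ s
      closedWalk-reverse s = ≡.trans (≡.cong (pathᵇ G) (closedWalk-reverse-list s)) (pathᵇ-reverse (v ∷ s ++ [ v ]))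

      minorAvoiding-reverse : ∀ s → minorAvoiding (reverse s) ≡ minorAvoiding s
      minorAvoiding-reverse s = ≡.cong principalMinor (filter-cong (allFin N) (λ w → ≡.cong (λ z → others w ∧ not z) (elem-rev w s)))

      closedWalkGain-reverse : ∀ s → closedWalkᵇ s ≡ true → closedWalkGain (reverse s) ≈ f (closedWalkGain s)
      closedWalkGain-reverse s pc = trans (reflexive (≡.cong gain (closedWalk-reverse-list s))) (pathGain-reverse (v ∷ s ++ [ v ]) pc)

      oriented-reverse : ∀ a b r → distinctᵇ (a ∷ b ∷ r) ≡ true → not (orientedᵇ (reverse (a ∷ b ∷ r))) ≡ orientedᵇ (a ∷ b ∷ r)
      oriented-reverse a b r d = ≡.trans (≡.cong₂ (λ p q → not (toℕ p <ᵇ toℕ q)) (hd-rev {G = G} v a (b ∷ r)) (last-rev {G = G} v a (b ∷ r)))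
                        (not-<ᵇ-flip (toℕ a) (toℕ (lastOr G a (b ∷ r))) ends-differ)
        where
        ends-differ : toℕ a ≢ toℕ (lastOr G a (b ∷ r))
        ends-differ eq = case (≡.trans (≡.sym (≡.cong not (≡.trans (≡.cong (λ z → elemᵇ z (b ∷ r)) (FP.toℕ-injective eq)) (lastOr-elem {G = G} a b r)))) (proj₁ (∧-true d)))
          where case : false ≡ true → ⊥
                case ()

      backwardTerm-reverse : ∀ k a b r → backwardTerm k (reverse (a ∷ b ∷ r)) ≈ reversedTerm k (a ∷ b ∷ r)
      backwardTerm-reverse k a b r = cases (simpleᵇ s ∧ closedWalkᵇ s) ≡.refl
        where
        s = a ∷ b ∷ r
        fl1 : (simpleᵇ (reverse s) ∧ closedWalkᵇ (reverse s)) ≡ (simpleᵇ s ∧ closedWalkᵇ s)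
        fl1 = ≡.cong₂ _∧_ (simple-reverse s) (closedWalk-reverse s)
        cases : ∀ bb → (simpleᵇ s ∧ closedWalkᵇ s) ≡ bb → backwardTerm k (reverse s) ≈ reversedTerm k s
        cases false e = reflexive (≡.trans (if-false _ (≡.cong (_∧ not (orientedᵇ (reverse s))) (≡.trans fl1 e))) (≡.sym (if-false _ (≡.cong (_∧ orientedᵇ s) e))))
        cases true e = if-flag _ _ (≡.trans (≡.cong (_∧ not (orientedᵇ (reverse s))) (≡.trans fl1 e)) (≡.trans (oriented-reverse a b r dist) (≡.cong (_∧ orientedᵇ s) (≡.sym e))))
                         (*-cong (*-congˡ (closedWalkGain-reverse s pcT)) (reflexive (minorAvoiding-reverse s)))
          where
          dvT : simpleᵇ s ≡ true
          dvT = proj₁ (∧-true {simpleᵇ s} e)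
          pcT : closedWalkᵇ s ≡ true
          pcT = proj₂ (∧-true {simpleᵇ s} e)
          dist : distinctᵇ s ≡ true
          dist = proj₁ (∧-true {distinctᵇ s} dvT)

      canonicalCycleTerm : Fin N → List (Fin N) → Carrier
      canonicalCycleTerm u s = if canonicalCycleᵇ G (u ∷ s) then throughTerm (cyc (u ∷ s)) else 0#

      canonicalCycle-flags : ∀ dv pth adjl ge ltt na → ((dv ∧ na) ≡ true → ge ≡ true) →
        ((dv ∧ (pth ∧ (adjl ∧ (ge ∧ ltt)))) ∧ (dv ∧ na)) ≡ (((dv ∧ na) ∧ (pth ∧ adjl)) ∧ ltt)
      canonicalCycle-flags false pth adjl ge ltt na h = ≡.refl
      canonicalCycle-flags true pth adjl ge ltt false h = ∧-zeroʳ _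
      canonicalCycle-flags true pth adjl ge ltt true h rewrite h ≡.refl = lem pth adjl ltt
        where lem : ∀ a b c → ((a ∧ (b ∧ (true ∧ c))) ∧ true) ≡ ((true ∧ (a ∧ b)) ∧ c)
              lem true true true = ≡.refl
              lem true true false = ≡.refl
              lem true false c = ≡.refl
              lem false b c = ≡.refl

      canonicalCycle-fits : ∀ a b r → (canonicalCycleᵇ G (v ∷ a ∷ b ∷ r) ∧ fits used (cyc (v ∷ a ∷ b ∷ r))) ≡ ((simpleᵇ (a ∷ b ∷ r) ∧ closedWalkᵇ (a ∷ b ∷ r)) ∧ orientedᵇ (a ∷ b ∷ r))
      canonicalCycle-fits a b r =
        ≡.trans (≡.cong (λ z → canonicalCycleᵇ G (v ∷ s) ∧ (distinctᵇ (v ∷ s) ∧ not (z ∨ any used s))) uv)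
        (≡.trans (canonicalCycle-flags (distinctᵇ (v ∷ s)) (pathᵇ G (v ∷ s)) (adj (lastOr G b r) v) (all (λ w → toℕ v ≤ᵇ toℕ w) s) (toℕ a <ᵇ toℕ (lastOr G b r)) (not (any used s)) geImp)
         (≡.cong (_∧ (toℕ a <ᵇ toℕ (lastOr G b r))) (≡.cong₂ _∧_ (≡.sym (simple-others s)) (≡.sym (pathᵇ-snoc {G = G} v s v)))))
        where
        s = a ∷ b ∷ r
        geImp : (distinctᵇ (v ∷ s) ∧ not (any used s)) ≡ true → all (λ w → toℕ v ≤ᵇ toℕ w) s ≡ true
        geImp e = all-mono s least-≤ (≡.trans (all-not used s) (proj₂ (∧-true {distinctᵇ (v ∷ s)} e)))

      canonicalCycleTerm≈cycleTerm : ∀ a b r → canonicalCycleTerm v (a ∷ b ∷ r) ≈ cycleTerm (length (a ∷ b ∷ r)) (a ∷ b ∷ r)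
      canonicalCycleTerm≈cycleTerm a b r = begin
        canonicalCycleTerm v s ≡⟨ ≡.cong (λ z → if canonicalCycleᵇ G (v ∷ s) then z else 0#) (if-true _ (≡.cong (_∨ elemᵇ v s) (==-refl v))) ⟩
        (if canonicalCycleᵇ G (v ∷ s) then signedWeight (cyc (v ∷ s)) * (if fits used (cyc (v ∷ s)) then minorOutside (v ∷ s) else 0#) else 0#)
          ≈⟨ if-nest (canonicalCycleᵇ G (v ∷ s)) _ _ _ ⟩
        (if canonicalCycleᵇ G (v ∷ s) ∧ fits used (cyc (v ∷ s)) then signedWeight (cyc (v ∷ s)) * minorOutside (v ∷ s) else 0#)
          ≈⟨ if-flag _ _ (canonicalCycle-fits a b r) (*-cong (*-congʳ (negOnePow-evenCount (length s))) (reflexive (minorOutside-cons s))) ⟩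
        cycleTerm (length s) s ∎
        where s = a ∷ b ∷ r

      forward+reversed : ∀ k s → forwardTerm k s + reversedTerm k s ≈ cycleTerm k s
      forward+reversed k s with (simpleᵇ s ∧ closedWalkᵇ s) ∧ orientedᵇ s
      ... | true = solve 4 (λ a b c d → a :* b :* d :+ a :* c :* d := a :* (b :+ c) :* d) refl _ _ _ _
      ... | false = +-identityˡ _

      sum-cong-long : ∀ k' (H1 H2 : List (Fin N) → Carrier) → (∀ a b r → length (a ∷ b ∷ r) ≡ suc (suc k') → H1 (a ∷ b ∷ r) ≈ H2 (a ∷ b ∷ r)) →
        ∑ (map H1 (listsOfLength N (suc (suc k')))) ≈ ∑ (map H2 (listsOfLength N (suc (suc k'))))
      sum-cong-long k' H1 H2 h = sum-cong-∈ (listsOfLength N (suc (suc k'))) go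
        where
        go : ∀ s → s ∈ listsOfLength N (suc (suc k')) → H1 s ≈ H2 s
        go (a ∷ b ∷ r) m = h a b r (listsOfLength-length (suc (suc k')) _ m)
        go [] m with listsOfLength-length (suc (suc k')) _ m
        ... | ()
        go (a ∷ []) m with listsOfLength-length (suc (suc k')) _ m
        ... | ()

      -- A closed walk v t₁ … t_k v with k ≥ 2 and its reverse trace the same cycle; the one with
      -- t₁ < t_k is its canonical listing, and reversing the other turns φ(C) into f(φ(C)).
      walkSum≈∑canonicalCycles : ∀ k' → walkSum v v others (suc (suc k')) ≈ ∑ (map (canonicalCycleTerm v) (listsOfLength N (suc (suc k'))))
      walkSum≈∑canonicalCycles k' = begin
        ∑ (map (walkTerm v v others K) Ls)
          ≈⟨ sum-cong-long k' _ _ (λ a b r _ → trans (walkTerm≈closedWalkTerm K a (b ∷ r))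
                                                (if-split (simpleᵇ (a ∷ b ∷ r) ∧ closedWalkᵇ (a ∷ b ∷ r)) (orientedᵇ (a ∷ b ∷ r)) _)) ⟩
        ∑ (map (λ s → forwardTerm K s + backwardTerm K s) Ls)
          ≈⟨ sum-+ (forwardTerm K) (backwardTerm K) Ls ⟩
        ∑ (map (forwardTerm K) Ls) + ∑ (map (backwardTerm K) Ls)
          ≈⟨ +-congˡ (SumsOverLists.sum-listsOfLength-reverse F K (backwardTerm K)) ⟩
        ∑ (map (forwardTerm K) Ls) + ∑ (map (λ s → backwardTerm K (reverse s)) Ls)
          ≈⟨ +-congˡ (sum-cong-long k' _ _ (λ a b r _ → backwardTerm-reverse K a b r)) ⟩
        ∑ (map (forwardTerm K) Ls) + ∑ (map (reversedTerm K) Ls)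
          ≈⟨ sym (sum-+ (forwardTerm K) (reversedTerm K) Ls) ⟩
        ∑ (map (λ s → forwardTerm K s + reversedTerm K s) Ls)
          ≈⟨ sum-cong Ls (forward+reversed K) ⟩
        ∑ (map (cycleTerm K) Ls)
          ≈⟨ sum-cong-long k' _ _ (λ a b r e → sym (trans (canonicalCycleTerm≈cycleTerm a b r) (reflexive (≡.cong (λ z → cycleTerm z (a ∷ b ∷ r)) e)))) ⟩
        ∑ (map (canonicalCycleTerm v) Ls) ∎
        where
        K = suc (suc k')
        Ls = listsOfLength N K

      all-elem : ∀ (q : Fin N → Bool) s w → all q s ≡ true → elemᵇ w s ≡ true → q w ≡ true
      all-elem q (y ∷ s) w a e = cases (y == w) ≡.refl
        where
        cases : ∀ b → (y == w) ≡ b → q w ≡ true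
        cases true yw = ≡.subst (λ z → q z ≡ true) (==-true y w yw) (proj₁ (∧-true {q y} a))
        cases false yw = all-elem q s w (proj₂ (∧-true {q y} a)) (≡.trans (≡.sym (≡.cong (_∨ elemᵇ w s) yw)) e)

      canonicalCycleTerm-notLeast : ∀ u s → (u == v) ≡ false → canonicalCycleTerm u s ≈ 0#
      canonicalCycleTerm-notLeast u [] u≢v = refl
      canonicalCycleTerm-notLeast u (a ∷ []) u≢v = refl
      canonicalCycleTerm-notLeast u (a ∷ b ∷ r) u≢v = cases (canonicalCycleᵇ G (u ∷ a ∷ b ∷ r)) ≡.refl
        where
        s = a ∷ b ∷ r
        cases : ∀ cb → canonicalCycleᵇ G (u ∷ s) ≡ cb → canonicalCycleTerm u s ≈ 0#
        cases false e = reflexive (if-false _ e)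
        cases true e = trans (reflexive (if-true _ e)) (cases2 (elemᵇ v s) ≡.refl)
          where
          geU : all (λ w → toℕ u ≤ᵇ toℕ w) s ≡ true
          geU = proj₁ (∧-true {all (λ w → toℕ u ≤ᵇ toℕ w) s} (proj₂ (∧-true {adj (lastOr G b r) u} (proj₂ (∧-true {pathᵇ G (u ∷ s)} (proj₂ (∧-true {distinctᵇ (u ∷ s)} e)))))))
          cases2 : ∀ eb → elemᵇ v s ≡ eb → throughTerm (cyc (u ∷ s)) ≈ 0#
          cases2 false ev = reflexive (if-false _ (≡.cong₂ _∨_ u≢v ev))
          cases2 true ev = throughTerm-unfit (cyc (u ∷ s)) (≡.trans (≡.cong (λ z → distinctᵇ (u ∷ s) ∧ not (z ∨ any used s)) usedU) (∧-zeroʳ _))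
            where
            u≤v : toℕ u ≤ toℕ v
            u≤v = NP.≤ᵇ⇒≤ (toℕ u) (toℕ v) (≡true⇒T (all-elem (λ w → toℕ u ≤ᵇ toℕ w) s v geU ev))
            usedU : used u ≡ true
            usedU = below u (NP.≤∧≢⇒< u≤v (λ eq → ==-false⇒≢ u v u≢v (FP.toℕ-injective eq)))

      cyclesOfLength : ℕ → Carrier
      cyclesOfLength k = ∑ (map (canonicalCycleTerm v) (listsOfLength N k))

      ∑cycles≈∑cyclesOfLength : ∑ (map throughTerm (allCycles G)) ≈ ∑ (map cyclesOfLength (upTo N))
      ∑cycles≈∑cyclesOfLength = begin
        ∑ (map throughTerm (map cyc (filterᵇ (canonicalCycleᵇ G) L)))
          ≡⟨ ≡.cong ∑ (≡.sym (LP.map-∘ (filterᵇ (canonicalCycleᵇ G) L))) ⟩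
        ∑ (map (λ us → throughTerm (cyc us)) (filterᵇ (canonicalCycleᵇ G) L))
          ≈⟨ sum-filter (canonicalCycleᵇ G) _ L ⟩
        ∑ (map (λ us → if canonicalCycleᵇ G us then throughTerm (cyc us) else 0#) L)
          ≈⟨ sum-concatMap _ (listsOfLength N) (upTo (suc N)) ⟩
        ∑ (map (λ k → ∑ (map (λ us → if canonicalCycleᵇ G us then throughTerm (cyc us) else 0#) (listsOfLength N k))) (upTo (suc N)))
          ≡⟨ ≡.cong (λ z → ∑ (map (λ k → ∑ (map (λ us → if canonicalCycleᵇ G us then throughTerm (cyc us) else 0#) (listsOfLength N k))) z)) (upTo-suc N) ⟩
        (0# + 0#) + ∑ (map (λ k → ∑ (map (λ us → if canonicalCycleᵇ G us then throughTerm (cyc us) else 0#) (listsOfLength N k))) (map suc (upTo N)))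
          ≈⟨ +-cong (+-identityʳ _) (reflexive (≡.cong ∑ (≡.sym (LP.map-∘ (upTo N))))) ⟩
        0# + ∑ (map (λ k → ∑ (map (λ us → if canonicalCycleᵇ G us then throughTerm (cyc us) else 0#) (listsOfLength N (suc k)))) (upTo N))
          ≈⟨ +-identityˡ _ ⟩
        ∑ (map (λ k → ∑ (map (λ us → if canonicalCycleᵇ G us then throughTerm (cyc us) else 0#) (listsOfLength N (suc k)))) (upTo N))
          ≈⟨ sum-cong (upTo N) (λ k → trans (SumsOverLists.sum-listsOfLength-cons F {N} k (λ us → if canonicalCycleᵇ G us then throughTerm (cyc us) else 0#)) (sum-single v (λ u → ∑ (map (canonicalCycleTerm u) (listsOfLength N k))) (allFin N) (allFin⁺ N) (∈-allFin v)
                 (λ u uv → sum-zero _ (listsOfLength N k) (λ s _ → canonicalCycleTerm-notLeast u s uv)))) ⟩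
        ∑ (map cyclesOfLength (upTo N)) ∎
        where L = concatMap (listsOfLength N) (upTo (suc N))

      cyclesOfLength-0 : cyclesOfLength 0 ≈ 0#
      cyclesOfLength-0 = +-identityʳ _

      cyclesOfLength-1 : cyclesOfLength 1 ≈ 0#
      cyclesOfLength-1 = trans (SumsOverLists.sum-listsOfLength-cons F 0 (canonicalCycleTerm v)) (sum-zero _ (allFin N) (λ t _ → +-identityʳ _))

      walkSum-decompose : ∀ k → walkSum v v others k ≈ onlyAt0 k (walkSum v v others 0) + (onlyAt1 k (walkSum v v others 1) + cyclesOfLength k)
      walkSum-decompose zero = sym (trans (+-congˡ (trans (+-identityˡ _) cyclesOfLength-0)) (+-identityʳ _))
      walkSum-decompose (suc zero) = sym (trans (+-identityˡ _) (trans (+-congˡ cyclesOfLength-1) (+-identityʳ _)))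
      walkSum-decompose (suc (suc k)) = trans (walkSum≈∑canonicalCycles k) (sym (trans (+-identityˡ _) (+-identityˡ _)))

      walkSum₁-trivial : N ≡ 1 → walkSum v v others 1 ≈ 0#
      walkSum₁-trivial eq = trans (SumsOverLists.sum-listsOfLength-cons F {N} 0 (walkTerm v v others 1)) (sum-zero _ (allFin N) (λ t _ → trans (+-identityʳ _)
                     (reflexive (if-false _ (≡.cong (_∧ true) (≡.trans (≡.cong (λ z → not (used t) ∧ not z) (tv t)) (∧-zeroʳ (not (used t)))))))))
        where
        z0 : ∀ (i : Fin N) → toℕ i ≡ 0
        z0 i = NP.n<1⇒n≡0 (≡.subst (toℕ i <_) eq (FP.toℕ<n i))
        tv : ∀ t → (t == v) ≡ true
        tv t = ≡.trans (≡.cong (_== v) (FP.toℕ-injective (≡.trans (z0 t) (≡.sym (z0 v))))) (==-refl v)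

      sum-allComps : ∑ (map throughTerm (allComps G)) ≈ ∑ (map throughTerm (allK2 G)) + ∑ (map throughTerm (allCycles G))
      sum-allComps = trans (reflexive (≡.cong ∑ (LP.map-++ throughTerm (allK2 G) (allCycles G)))) (sum-++ (map throughTerm (allK2 G)) _)

      ∑walkSum≈diag+componentsThrough : ∑ (map (walkSum v v others) (upTo N)) ≈ diag v * principalMinor (vertices others) + ∑ (map throughTerm (allComps G))
      ∑walkSum≈diag+componentsThrough = begin
        ∑ (map (walkSum v v others) (upTo N))
          ≈⟨ sum-cong (upTo N) walkSum-decompose ⟩
        ∑ (map (λ k → onlyAt0 k walk₀ + (onlyAt1 k walk₁ + cyclesOfLength k)) (upTo N))
          ≈⟨ trans (sum-+ _ _ (upTo N)) (+-congˡ (sum-+ _ _ (upTo N))) ⟩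
        ∑ (map (λ k → onlyAt0 k walk₀) (upTo N)) + (∑ (map (λ k → onlyAt1 k walk₁) (upTo N)) + ∑ (map cyclesOfLength (upTo N)))
          ≈⟨ +-cong (trans (reflexive (≡.cong (λ z → ∑ (map (λ k → onlyAt0 k walk₀) (upTo z))) N≡sucN′)) (trans (sum-onlyAt0 N′ walk₀) walkSum₀))
                    (+-cong (sum-onlyAt1-walk₁ N′ N≡sucN′) (sym ∑cycles≈∑cyclesOfLength)) ⟩
        diag v * principalMinor (vertices others) + (∑ (map throughTerm (allK2 G)) + ∑ (map throughTerm (allCycles G)))
          ≈⟨ +-congˡ (sym sum-allComps) ⟩
        diag v * principalMinor (vertices others) + ∑ (map throughTerm (allComps G)) ∎
        where
        walk₀ = walkSum v v others 0
        walk₁ = walkSum v v others 1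
        N′ = proj₁ (Fin⇒suc v)
        N≡sucN′ = proj₂ (Fin⇒suc v)
        edges≈walk₁ : ∑ (map throughTerm (allK2 G)) ≈ walk₁
        edges≈walk₁ = trans ∑edges≈edgesAt edgesAt≈walkSum₁
        sum-onlyAt1-walk₁ : ∀ n' → N ≡ suc n' → ∑ (map (λ k → onlyAt1 k walk₁) (upTo N)) ≈ ∑ (map throughTerm (allK2 G))
        sum-onlyAt1-walk₁ zero e = trans (reflexive (≡.cong (λ z → ∑ (map (λ k → onlyAt1 k walk₁) (upTo z))) e))
                            (trans (+-identityʳ _) (sym (trans edges≈walk₁ (walkSum₁-trivial e))))
        sum-onlyAt1-walk₁ (suc n'') e = trans (reflexive (≡.cong (λ z → ∑ (map (λ k → onlyAt1 k walk₁) (upTo z))) e)) (trans (sum-onlyAt1 n'' walk₁) (sym edges≈walk₁))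


module MinorsAsComponentSums where

  open import Algebra.Bundles using (CommutativeRing)
  open import Data.Bool using (Bool; true; false; if_then_else_; not; _∧_; _∨_; T)
  open import Data.Nat using (ℕ; zero; suc; _<_; _≤_; s≤s; _<ᵇ_)
  import Data.Nat.Properties as NP
  open import Data.Fin using (Fin; zero; suc; toℕ)
  open import Data.List using (List; []; _∷_; [_]; map; allFin; filterᵇ; length; upTo; concatMap)
  import Data.List.Properties as LP
  open import Data.List.Membership.Propositional using (_∈_)
  open import Data.List.Membership.Propositional.Properties using (∈-allFin; ∈-++⁻; ∈-map⁻; ∈-filter⁻)
  open import Data.List.Relation.Unary.Any using (here; there)
  open import Data.List.Relation.Unary.All as All using (All; []; _∷_)
  import Data.List.Relation.Unary.All.Properties as AP
  open import Relation.Binary.PropositionalEquality as ≡ using (_≡_)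
  open import Relation.Nullary.Decidable using (T?)
  open import Data.Empty using (⊥-elim; ⊥)
  open import Data.Unit using (⊤; tt)
  open import Data.Sum using (inj₁; inj₂)
  open import Data.Product using (Σ; _×_; _,_; proj₁; proj₂)
  open import Function using (_∘_)
  open import Defs
  open Summation
  open FinBool
  open ListBool
  open ListDeterminant
  open ComponentSums
  open VertexExpansion

  filter-map-suc : ∀ {n} (q : Fin (suc n) → Bool) (xs : List (Fin n)) → filterᵇ q (map suc xs) ≡ map suc (filterᵇ (q ∘ suc) xs)
  filter-map-suc q [] = ≡.refl
  filter-map-suc q (x ∷ xs) with q (suc x)
  ... | true = ≡.cong (suc x ∷_) (filter-map-suc q xs)
  ... | false = filter-map-suc q xs

  filter-empty : ∀ {a} {A : Set a} (p : A → Bool) xs → filterᵇ p xs ≡ [] → ∀ w → w ∈ xs → p w ≡ false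
  filter-empty p (x ∷ xs) e w m with p x in px
  filter-empty p (x ∷ xs) () w m | true
  filter-empty p (x ∷ xs) e w (here ≡.refl) | false = px
  filter-empty p (x ∷ xs) e w (there m) | false = filter-empty p xs e w m

  LeastOf : ∀ {n} → (Fin n → Bool) → Fin n → List (Fin n) → Set
  LeastOf {n} p v T = (p v ≡ true) × ((∀ w → toℕ w < toℕ v → p w ≡ false) × (T ≡ filterᵇ (λ w → p w ∧ not (w == v)) (allFin n)))

  filter-allFin-least : ∀ {n} (p : Fin n → Bool) v T → filterᵇ p (allFin n) ≡ v ∷ T → LeastOf p v T
  filter-allFin-least {suc n} p v T' e = cases (p zero) ≡.refl
    where
    e₀ : filterᵇ p (zero ∷ map suc (allFin n)) ≡ v ∷ T'
    e₀ = ≡.trans (≡.cong (filterᵇ p) (≡.sym (allFin-suc n))) e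
    cases : ∀ b → p zero ≡ b → LeastOf p v T'
    cases true pz with LP.∷-injective (≡.trans (≡.sym (filter-true p zero _ pz)) e₀)
    ... | ≡.refl , eT = pz , (λ w ()) , ≡.sym (≡.trans (≡.cong (filterᵇ without-0) (allFin-suc n))
           (≡.trans (filter-false without-0 zero (map suc (allFin n)) (≡.cong (λ b → b ∧ false) pz))
           (≡.trans (filter-map-suc without-0 (allFin n)) (≡.trans (≡.cong (map suc) (filter-cong (allFin n) (λ w → ∧-identityʳ (p (suc w)))))
             (≡.trans (≡.sym (filter-map-suc p (allFin n))) eT)))))
      where
      without-0 : Fin (suc n) → Bool
      without-0 w = p w ∧ not (w == zero)
    cases false pz = byTail (filterᵇ (p ∘ suc) (allFin n)) ≡.refl
      where
      e₁ : map suc (filterᵇ (p ∘ suc) (allFin n)) ≡ v ∷ T'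
      e₁ = ≡.trans (≡.sym (filter-map-suc p (allFin n))) (≡.trans (≡.sym (filter-false p zero _ pz)) e₀)
      byTail : ∀ L → filterᵇ (p ∘ suc) (allFin n) ≡ L → LeastOf p v T'
      byTail [] eL with ≡.trans (≡.sym (≡.cong (map suc) eL)) e₁
      ... | ()
      byTail (v' ∷ T'') eL with LP.∷-injective (≡.trans (≡.sym (≡.cong (map suc) eL)) e₁)
      ... | ≡.refl , eT with filter-allFin-least (p ∘ suc) v' T'' eL
      ...   | pv , below , eT'' = pv , below-suc , ≡.sym (≡.trans (≡.cong (filterᵇ q) (allFin-suc n))
                (≡.trans (filter-false q zero (map suc (allFin n)) (≡.cong (λ b → b ∧ not (zero == suc v')) pz))
                (≡.trans (filter-map-suc q (allFin n)) (≡.trans (≡.cong (map suc) (≡.sym eT'')) eT))))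
        where
        q : Fin (suc n) → Bool
        q w = p w ∧ not (w == suc v')
        below-suc : ∀ w → toℕ w < toℕ (suc v') → p w ≡ false
        below-suc zero _ = pz
        below-suc (suc w) (s≤s lt) = below w lt

  module _ {N : ℕ} (G : SimpleGraph N) where
    open SimpleGraph G

    isK2 : Comp G → Set
    isK2 (k2 _ _) = ⊤
    isK2 (cyc _) = ⊥

    allK2-areK2 : All isK2 (allK2 G)
    allK2-areK2 = AP.concat⁺ (AP.map⁺ (All.universal (λ i → AP.concat⁺ (AP.map⁺ (All.universal (λ j → h ((toℕ i <ᵇ toℕ j) ∧ adj i j) i j) (allFin N)))) (allFin N)))
      where
      h : ∀ b i j → All isK2 (if b then k2 i j ∷ [] else [])
      h true i j = tt ∷ []
      h false i j = []

    comps-nonempty : ∀ c → c ∈ allComps G → Σ (Fin N) (λ w → elemᵇ w (compVerts G c) ≡ true)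
    comps-nonempty (k2 i j) _ = i , ≡.cong (_∨ elemᵇ i (j ∷ [])) (==-refl i)
    comps-nonempty (cyc (u ∷ us)) _ = u , ≡.cong (_∨ elemᵇ u us) (==-refl u)
    comps-nonempty (cyc []) m with ∈-++⁻ (allK2 G) m
    ... | inj₁ m1 = ⊥-elim (All.lookup allK2-areK2 m1)
    ... | inj₂ m2 with ∈-map⁻ cyc m2
    ...   | us , mus , eq with eq
    ...     | ≡.refl = ⊥-elim (proj₂ (∈-filter⁻ (T? ∘ canonicalCycleᵇ G) {xs = concatMap (listsOfLength N) (upTo (suc N))} mus))

  module PrincipalMinors {c ℓ} (F : CommutativeRing c ℓ) (fld : IsFieldCharZero F)
            (f : CommutativeRing.Carrier F → CommutativeRing.Carrier F) (inv : IsInvolutiveAutUnits F f)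
            {N : ℕ} (G : SimpleGraph N) (φ : Fin N → Fin N → CommutativeRing.Carrier F) (sk : IsSkewGain F G f φ)
            (x : CommutativeRing.Carrier F) where
    open CommutativeRing F hiding (zero)
    open import Relation.Binary.Reasoning.Setoid setoid
    open Sums F
    open AtPoint F fld f inv G φ sk x public

    comps : List (Comp G)
    comps = allComps G

    free : (Fin N → Bool) → Fin N → Bool
    free used w = not (used w)

    Expands : (Fin N → Bool) → Set ℓ
    Expands used = principalMinor (vertices (free used)) ≈ componentSum true used comps

    length-vertices≤ : ∀ (p : Fin N → Bool) → length (vertices p) ≤ N
    length-vertices≤ p = ≡.subst (length (vertices p) ≤_) (LP.length-tabulate (λ i → i)) (LP.length-filter (T? ∘ p) (allFin N))

    cover-others : ∀ (used : Fin N → Bool) v X → elemᵇ v X ≡ true → ∀ w → free (cover used X) w ≡ true → (free used w ∧ not (w == v)) ≡ true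
    cover-others used v X ev w e with used w | elemᵇ w X in ew | w == v in wv
    ... | false | false | false = ≡.refl
    ... | false | false | true rewrite ==-true w v wv with () ← ≡.trans (≡.sym ev) ew

    expands-empty : ∀ used → vertices (free used) ≡ [] → Expands used
    expands-empty used e = begin
      principalMinor (vertices (free used)) ≡⟨ ≡.cong principalMinor e ⟩
      1#                                    ≡⟨ ≡.cong (λ z → prodL F (map diag z)) (≡.sym e) ⟩
      componentSum true used []             ≈⟨ componentSum-covered true used comps covered (comps-nonempty G) ⟨
      componentSum true used comps          ∎
      where
      covered : ∀ w → used w ≡ true
      covered w = not-false (filter-empty _ (allFin N) e w (∈-allFin w))

    module LeastFreeVertex (fuel : ℕ) (IH : ∀ used → length (vertices (free used)) < fuel → Expands used)
                           (used : Fin N → Bool) (v : Fin N) (T : List (Fin N)) (e : vertices (free used) ≡ v ∷ T)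
                           (bound : length (vertices (free used)) < suc fuel) where
      least : LeastOf (free used) v T
      least = filter-allFin-least (free used) v T e

      uv : used v ≡ false
      uv = not-true (proj₁ least)

      below : ∀ w → toℕ w < toℕ v → used w ≡ true
      below w w<v = not-false (proj₁ (proj₂ least) w w<v)

      open LeastVertex v used uv below

      length-free : length (vertices (free used)) ≡ suc (length (vertices others))
      length-free = ≡.trans (≡.cong length e) (≡.cong (suc ∘ length) (proj₂ (proj₂ least)))

      others<fuel : length (vertices others) < fuel
      others<fuel = NP.≤-pred (≡.subst (_< suc fuel) length-free bound)

      free-cover-[v] : vertices (free (cover used [ v ])) ≡ vertices others
      free-cover-[v] = filter-cong (allFin N) (λ w → ≡.trans (≡.cong (λ z → not (used w ∨ (z ∨ false))) (==-sym v w)) (lem (used w) (w == v)))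
        where lem : ∀ a b → not (a ∨ (b ∨ false)) ≡ (not a ∧ not b)
              lem true  b     = ≡.refl
              lem false true  = ≡.refl
              lem false false = ≡.refl

      componentsThrough≈throughTerm : ∀ c →
        (if elemᵇ v (verts c) then signedWeight c * componentSum (true ∧ fits used c) (cover used (verts c)) comps else 0#) ≈ throughTerm c
      componentsThrough≈throughTerm c = if-cong (elemᵇ v (verts c)) (λ ev → *-congˡ (byFit (fits used c) ≡.refl ev))
        where
        byFit : ∀ b → fits used c ≡ b → elemᵇ v (verts c) ≡ true →
          componentSum (true ∧ fits used c) (cover used (verts c)) comps ≈ (if fits used c then minorOutside (verts c) else 0#)
        byFit false fc ev = trans (componentSum-false _ comps fc) (reflexive (≡.sym (if-false _ fc)))
        byFit true  fc ev = trans (componentSum-cong comps fc (λ _ → ≡.refl))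
          (trans (sym (IH (cover used (verts c)) (NP.≤-<-trans shrink others<fuel))) (reflexive (≡.sym (if-true _ fc))))
          where
          shrink : length (vertices (free (cover used (verts c)))) ≤ length (vertices others)
          shrink = length-filter-mono others (free (cover used (verts c))) (cover-others used v (verts c) ev) (allFin N)

      expands : Expands used
      expands = begin
        principalMinor (vertices (free used))
          ≡⟨ ≡.cong principalMinor (≡.trans e (≡.cong (v ∷_) (proj₂ (proj₂ least)))) ⟩
        borderedMinor v v (vertices others)
          ≈⟨ borderedMinor≈∑walkSum N v v others (≡.subst (_≤ N) length-free (length-vertices≤ (free used))) ⟩
        ∑ (map (walkSum v v others) (upTo N))
          ≈⟨ ∑walkSum≈diag+componentsThrough ⟩
        diag v * principalMinor (vertices others) + ∑ (map throughTerm comps)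
          ≈⟨ +-cong (*-congˡ (trans (reflexive (≡.cong principalMinor (≡.sym free-cover-[v])))
                                    (IH (cover used [ v ]) (≡.subst (λ z → length z < fuel) (≡.sym free-cover-[v]) others<fuel))))
                    (sym (sum-cong comps componentsThrough≈throughTerm)) ⟩
        diag v * componentSum true (cover used [ v ]) comps + componentsThrough v true used comps comps
          ≈⟨ componentSum-split v true used comps uv ⟨
        componentSum true used comps ∎

    principalMinor≈componentSum : ∀ fuel used → length (vertices (free used)) < fuel → Expands used
    principalMinor≈componentSum (suc fuel) used bound = byFreeVertices (vertices (free used)) ≡.refl
      where
      byFreeVertices : ∀ S → vertices (free used) ≡ S → Expands used
      byFreeVertices []      e = expands-empty used e
      byFreeVertices (v ∷ T) e = LeastFreeVertex.expands fuel (principalMinor≈componentSum fuel) used v T e bound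


mainTheorem1 : ∀ {c ℓ} (F : CommutativeRing c ℓ) → IsFieldCharZero F →
    (f : CommutativeRing.Carrier F → CommutativeRing.Carrier F) → IsInvolutiveAutUnits F f →
    (n : ℕ) (G : SimpleGraph n) → Connected G →
    (φ : Fin n → Fin n → CommutativeRing.Carrier F) → IsSkewGain F G f φ →
    (x : CommutativeRing.Carrier F) →
    CommutativeRing._≈_ F (charPoly F G f φ x) (rhs F G f φ x)
mainTheorem1 F fld f inv n G _ φ sk x = begin
  det F n M                                     ≈⟨ ListDeterminant.Laplace.det≈minor F n M ⟩
  principalMinor (allFin n)                     ≡⟨ ≡.cong principalMinor (≡.sym (filter-all-true (allFin n))) ⟩
  principalMinor (vertices (free noneUsed))     ≈⟨ principalMinor≈componentSum (suc n) noneUsed (s≤s (length-vertices≤ _)) ⟩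
  componentSum true noneUsed (allComps G)       ≈⟨ rhs≈componentSum ⟨
  rhs F G f φ x                                 ∎
  where
  open import Relation.Binary.Reasoning.Setoid (CommutativeRing.setoid F)
  open FinBool using (filter-all-true)
  open MinorsAsComponentSums.PrincipalMinors F fld f inv G φ sk x
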